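{- Let $I_1$, $I_3$ and $G$ be as described in the context, and let $L=91.8m$, where $m$ is the number of equations of $I_1$. If there exists a truth assignment to the variables of $I_3$ that leaves at most $k$ clauses of $I_3$ unsatisfied, then there exists a tour of $G$ with cost at most $L+k$.
   Context: Let $I_1$ be a system of $m$ linear equations over $\mathbb{Z}_2$ in variables $x_1,\dots,x_n$, each of the form $x_{i_1}+x_{i_2}+x_{i_3}=b$ with exactly three variables and $b\in\{0,1\}$. For each $i\in[n]$ let $d(i)$ be the number of occurrences of $x_i$ in $I_1$, and assume each $d(i)$ is a positive multiple of $5$; the occurrences of $x_i$ are numbered $1,\dots,d(i)$. For each $i$ fix a bipartite graph $H_i$ with left vertex set $[d(i)]$ and right vertex set $[0.8d(i)]$ (taken disjoint), every left vertex of degree $4$, every right vertex of degree $5$, such that for every vertex set $S$ with $|S\cap\text{Left}|\le d(i)/2$, at least $|S\cap \text{Left}|$ edges of $H_i$ have exactly one endpoint in $S$. The instance $I_3$ of Max-1-in-3-SAT: variables are the main variables $x_{(i,j)}$ ($i\in[n]$, $j\in[d(i)]$), checker variables $y_{(i,k)}$ ($i\in[n]$, $k\in[0.8d(i)]$), and auxiliary variables $a_{(\ell,1)},a_{(\ell,2)},a_{(\ell,3)}$ for each equation index $\ell\in[m]$. Clauses: for each $i$ and each edge $(j,k)$ of $H_i$, the clause $(x_{(i,j)}\lor y_{(i,k)})$. For the $\ell$-th equation $x_{i_1}+x_{i_2}+x_{i_3}=b$, being the $j_1$-th, $j_2$-th, $j_3$-th occurrence of $x_{i_1},x_{i_2},x_{i_3}$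 respectively, the three clauses $(\lambda\lor a_{(\ell,1)}\lor a_{(\ell,2)})$, $(x_{(i_2,j_2)}\lor a_{(\ell,2)}\lor a_{(\ell,3)})$, $(x_{(i_3,j_3)}\lor a_{(\ell,1)}\lor a_{(\ell,3)})$, where $\lambda=x_{(i_1,j_1)}$ if $b=1$ and $\lambda=\neg x_{(i_1,j_1)}$ if $b=0$. A clause is satisfied by a truth assignment iff exactly one of its literals is true. The graph $G$ is an edge-weighted undirected multigraph in which some edges are designated forced. Vertices: a central vertex $s$; for each variable $z$ of $I_3$ two terminals $z^L,z^R$; for each clause $C$ and each variable $z$ occurring in $C$ an occurrence vertex $z^C$. Forced edges: $s z^L$ and $s z^R$ for every variable $z$, of weight $7/4$ if $z$ is a main or checker variable and $1/2$ if $z$ is auxiliary; for each two-literal clause $C=(x\lor y)$, two parallel forced edges between $x^C$ and $y^C$, each of weight $3/2$; for each three-literal clause $C$ with main variable $z$ and auxiliary variables $a,a'$, forced edges $z^Ca^C$ and $z^Ca'^C$ of weight $5/4$ and $a^Ca'^C$ of weight $1$. Non-forced edges (all of weight $1$): for each variable $z$, a "True path" from $z^L$ to $z^R$ passing, in some fixed order, through the occurrence vertices $z^C$ of all clauses $C$ in which $z$ appears as a positive literal, and a "False path" from $z^L$ to $z^R$ through the occurrence vertices of all clauses in which $z$ appears negated (if there are no such clauses, the path is a single edge $z^Lz^R$). A tour of $G$ is a multiset $E_T$ of edges of $G$ containing every forced edge at least once such that the multigraph $(V(G),E_T)$ is connected and all its degrees are even; its cost is $\sum_{e\in E_T}w(e)$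 (counted with multiplicity). -}

module Defs where

open import Data.Nat using (ℕ; zero; suc; _+_; _*_; _≤_; _<_; _≡ᵇ_)
open import Data.Nat.Divisibility using (_∣_)
open import Data.Nat.DivMod using (_/_)
open import Data.Bool using (Bool; true; false; if_then_else_; not; _∧_; _∨_; _xor_)
open import Data.Fin using (Fin; toℕ) renaming (zero to f0; suc to fs)
open import Data.Fin.Properties using () renaming (_≟_ to _≟F_)
open import Data.List using (List; []; _∷_; _++_; map; concatMap; upTo; allFin; cartesianProduct; filterᵇ; length; lookup)
open import Data.List.Membership.Propositional using (_∈_)
open import Data.List.Relation.Binary.Permutation.Propositional using (_↭_)
open import Data.Product using (Σ; _×_; _,_; proj₁; proj₂)
open import Data.Sum using (_⊎_)
open import Data.Integer using (+_)
open import Data.Rational using (ℚ) renaming (_/_ to _/ℚ_; _+_ to _+ℚ_; _*_ to _*ℚ_)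
open import Relation.Nullary.Decidable using (⌊_⌋)
open import Relation.Binary.PropositionalEquality using (_≡_)
open import Relation.Binary.Construct.Closure.ReflexiveTransitive using (Star)

countB : {A : Set} → (A → Bool) → List A → ℕ
countB p [] = 0
countB p (x ∷ xs) = (if p x then 1 else 0) + countB p xs

anyB : {A : Set} → (A → Bool) → List A → Bool
anyB p [] = false
anyB p (x ∷ xs) = p x ∨ anyB p xs

sumℕ : List ℕ → ℕ
sumℕ [] = 0
sumℕ (x ∷ xs) = x + sumℕ xs

sumℚ : List ℚ → ℚ
sumℚ [] = + 0 /ℚ 1
sumℚ (x ∷ xs) = x +ℚ sumℚ xs

eqF : {k : ℕ} → Fin k → Fin k → Bool
eqF x y = toℕ x ≡ᵇ toℕ y

-- The system I₁ of equations x_{i₁}+x_{i₂}+x_{i₃} = b over ℤ₂.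
-- Equation ℓ has variables var ℓ 0, var ℓ 1, var ℓ 2 and right-hand side
-- rhs ℓ (true = 1, false = 0).

record Sys : Set where
  field
    n m : ℕ
    var : Fin m → Fin 3 → Fin n
    rhs : Fin m → Bool
open Sys public

occs : (S : Sys) → List (Fin (m S) × Fin 3)
occs S = cartesianProduct (allFin (m S)) (allFin 3)

deg : (S : Sys) → Fin (n S) → ℕ
deg S i = countB (λ o → ⌊ var S (proj₁ o) (proj₂ o) ≟F i ⌋) (occs S)

-- 0.8 d(i)  (exact, since 5 ∣ d(i) is assumed)
rsz : (S : Sys) → Fin (n S) → ℕ
rsz S i = (4 * deg S i) / 5

-- Variables, literals, clauses of I₃ and vertices of G.
-- Indices are 0-based: X i j = x_{(i,j+1)}, Y i k = y_{(i,k+1)},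
-- A ℓ t = a_{(ℓ,t+1)}.

data V3 (n m : ℕ) : Set where
  X : Fin n → ℕ → V3 n m
  Y : Fin n → ℕ → V3 n m
  A : Fin m → Fin 3 → V3 n m

record Lit (n m : ℕ) : Set where
  constructor lit
  field
    lv   : V3 n m
    lpos : Bool      -- true = positive literal, false = negated
open Lit public

-- C2 i j k : the clause (x_{(i,j)} ∨ y_{(i,k)}) for the edge (j,k) of H_i
-- C3 ℓ t   : the (t+1)-th of the three clauses of equation ℓ
data Cl (n m : ℕ) : Set where
  C2 : Fin n → ℕ → ℕ → Cl n m
  C3 : Fin m → Fin 3 → Cl n m

data Vtx (n m : ℕ) : Set where
  s  : Vtx n m
  tL : V3 n m → Vtx n m
  tR : V3 n m → Vtx n m
  oc : V3 n m → Cl n m → Vtx n m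

eqV3 : {n m : ℕ} → V3 n m → V3 n m → Bool
eqV3 (X i j) (X i' j') = eqF i i' ∧ (j ≡ᵇ j')
eqV3 (Y i j) (Y i' j') = eqF i i' ∧ (j ≡ᵇ j')
eqV3 (A l t) (A l' t') = eqF l l' ∧ eqF t t'
eqV3 _ _ = false

eqCl : {n m : ℕ} → Cl n m → Cl n m → Bool
eqCl (C2 i j k) (C2 i' j' k') = eqF i i' ∧ ((j ≡ᵇ j') ∧ (k ≡ᵇ k'))
eqCl (C3 l t) (C3 l' t') = eqF l l' ∧ eqF t t'
eqCl _ _ = false

eqVtx : {n m : ℕ} → Vtx n m → Vtx n m → Bool
eqVtx s s = true
eqVtx (tL z) (tL z') = eqV3 z z'
eqVtx (tR z) (tR z') = eqV3 z z'
eqVtx (oc z c) (oc z' c') = eqV3 z z' ∧ eqCl c c'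
eqVtx _ _ = false

record Edge (n m : ℕ) : Set where
  constructor edge
  field
    eu ev  : Vtx n m
    ew     : ℚ
    forced : Bool
open Edge public

-- The construction, given I₁ (S), the numbering of occurrences (num:
-- the occurrence at position p of equation ℓ is the (num ℓ p + 1)-th
-- occurrence of x_{var ℓ p}), and the graphs H_i (H i j k = true iff
-- (j,k) is an edge of H_i, left vertex j, right vertex k, 0-based).

module Construction (S : Sys) (num : Fin (m S) → Fin 3 → ℕ)
                    (H : Fin (n S) → ℕ → ℕ → Bool) where

  V : Set
  V = V3 (n S) (m S)

  C : Set
  C = Cl (n S) (m S)

  xo : Fin (m S) → Fin 3 → V
  xo ℓ p = X (var S ℓ p) (num ℓ p)

  lits : C → List (Lit (n S) (m S))
  lits (C2 i j k) = lit (X i j) true ∷ lit (Y i k) true ∷ []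
  lits (C3 ℓ f0) = lit (xo ℓ f0) (rhs S ℓ) ∷ lit (A ℓ f0) true ∷ lit (A ℓ (fs f0)) true ∷ []
  lits (C3 ℓ (fs f0)) = lit (xo ℓ (fs f0)) true ∷ lit (A ℓ (fs f0)) true ∷ lit (A ℓ (fs (fs f0))) true ∷ []
  lits (C3 ℓ (fs (fs f0))) = lit (xo ℓ (fs (fs f0))) true ∷ lit (A ℓ f0) true ∷ lit (A ℓ (fs (fs f0))) true ∷ []

  allClauses : List C
  allClauses =
    concatMap (λ i → concatMap (λ j → map (C2 i j) (filterᵇ (H i j) (upTo (rsz S i))))
                                 (upTo (deg S i)))
              (allFin (n S))
    ++ concatMap (λ ℓ → map (C3 ℓ) (allFin 3)) (allFin (m S))

  allVars : List V
  allVars =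
    concatMap (λ i → map (X i) (upTo (deg S i)) ++ map (Y i) (upTo (rsz S i))) (allFin (n S))
    ++ concatMap (λ ℓ → map (A ℓ) (allFin 3)) (allFin (m S))

  litVal : (V → Bool) → Lit (n S) (m S) → Bool
  litVal σ (lit v true) = σ v
  litVal σ (lit v false) = not (σ v)

  satisfied : (V → Bool) → C → Bool
  satisfied σ c = countB (litVal σ) (lits c) ≡ᵇ 1

  numUnsat : (V → Bool) → ℕ
  numUnsat σ = countB (λ c → not (satisfied σ c)) allClauses

  occursWith : Bool → V → C → Bool
  occursWith b z c = anyB (λ l → eqV3 (lv l) z ∧ (if lpos l then b else not b)) (lits c)

  -- The graph G, given the orders P z (True path) and N z (False path).

  module Graph (P N : V → List C) where

    W : Set
    W = Vtx (n S) (m S)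

    wTerm : V → ℚ
    wTerm (A _ _) = + 1 /ℚ 2
    wTerm _       = + 7 /ℚ 4

    termEdges : V → List (Edge (n S) (m S))
    termEdges z = edge s (tL z) (wTerm z) true ∷ edge s (tR z) (wTerm z) true ∷ []

    tri : W → W → W → List (Edge (n S) (m S))
    tri z a a' = edge z a (+ 5 /ℚ 4) true ∷ edge z a' (+ 5 /ℚ 4) true ∷ edge a a' (+ 1 /ℚ 1) true ∷ []

    clauseEdges : C → List (Edge (n S) (m S))
    clauseEdges c@(C2 i j k) =
      edge (oc (X i j) c) (oc (Y i k) c) (+ 3 /ℚ 2) true
      ∷ edge (oc (X i j) c) (oc (Y i k) c) (+ 3 /ℚ 2) true ∷ []
    clauseEdges c@(C3 ℓ f0) = tri (oc (xo ℓ f0) c) (oc (A ℓ f0) c) (oc (A ℓ (fs f0)) c)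
    clauseEdges c@(C3 ℓ (fs f0)) = tri (oc (xo ℓ (fs f0)) c) (oc (A ℓ (fs f0)) c) (oc (A ℓ (fs (fs f0))) c)
    clauseEdges c@(C3 ℓ (fs (fs f0))) = tri (oc (xo ℓ (fs (fs f0))) c) (oc (A ℓ f0) c) (oc (A ℓ (fs (fs f0))) c)

    pathEdges : List W → List (Edge (n S) (m S))
    pathEdges (u ∷ v ∷ rest) = edge u v (+ 1 /ℚ 1) false ∷ pathEdges (v ∷ rest)
    pathEdges _ = []

    truePath : V → List (Edge (n S) (m S))
    truePath z = pathEdges (tL z ∷ (map (oc z) (P z) ++ (tR z ∷ [])))

    falsePath : V → List (Edge (n S) (m S))
    falsePath z = pathEdges (tL z ∷ (map (oc z) (N z) ++ (tR z ∷ [])))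

    edgesG : List (Edge (n S) (m S))
    edgesG = concatMap termEdges allVars
             ++ concatMap clauseEdges allClauses
             ++ concatMap (λ z → truePath z ++ falsePath z) allVars

    verticesG : List W
    verticesG = s ∷ (concatMap (λ z → tL z ∷ tR z ∷ []) allVars
                     ++ concatMap (λ c → map (λ l → oc (lv l) c) (lits c)) allClauses)

    -- a multiset of edges of G: multiplicity of each edge of the list edgesG
    Mult : Set
    Mult = Fin (length edgesG) → ℕ

    E : Fin (length edgesG) → Edge (n S) (m S)
    E e = lookup edgesG e

    incid : W → Edge (n S) (m S) → ℕ
    incid v d = (if eqVtx (eu d) v then 1 else 0) + (if eqVtx (ev d) v then 1 else 0)

    degT : Mult → W → ℕ
    degT μ v = sumℕ (map (λ e → μ e * incid v (E e)) (allFin (length edgesG)))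

    Adj : Mult → W → W → Set
    Adj μ u v = Σ (Fin (length edgesG)) λ e →
      1 ≤ μ e × ((eu (E e) ≡ u × ev (E e) ≡ v) ⊎ (eu (E e) ≡ v × ev (E e) ≡ u))

    IsTour : Mult → Set
    IsTour μ =
      (∀ e → forced (E e) ≡ true → 1 ≤ μ e)
      × (∀ v → 2 ∣ degT μ v)
      × (∀ u v → u ∈ verticesG → v ∈ verticesG → Star (Adj μ) u v)

    cost : Mult → ℚ
    cost μ = sumℚ (map (λ e → (+ μ e /ℚ 1) *ℚ ew (E e)) (allFin (length edgesG)))

  record Valid (P N : V → List C) : Set where
    field
      distinct : ∀ ℓ p q → var S ℓ p ≡ var S ℓ q → p ≡ q
      degMul5  : ∀ i → 5 ∣ deg S i
      degPos   : ∀ i → 0 < deg S i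
      numBound : ∀ ℓ p → num ℓ p < deg S (var S ℓ p)
      numInj   : ∀ ℓ p ℓ' p' → var S ℓ p ≡ var S ℓ' p' → num ℓ p ≡ num ℓ' p' →
                 ℓ ≡ ℓ' × p ≡ p'
      Hsupp    : ∀ i j k → H i j k ≡ true → j < deg S i × k < rsz S i
      Hleft    : ∀ i j → j < deg S i → countB (H i j) (upTo (rsz S i)) ≡ 4
      Hright   : ∀ i k → k < rsz S i → countB (λ j → H i j k) (upTo (deg S i)) ≡ 5
      Hexp     : ∀ i (SL SR : ℕ → Bool) →
                 2 * countB SL (upTo (deg S i)) ≤ deg S i →
                 countB SL (upTo (deg S i))
                   ≤ countB (λ jk → H i (proj₁ jk) (proj₂ jk) ∧ (SL (proj₁ jk) xor SR (proj₂ jk)))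
                            (cartesianProduct (upTo (deg S i)) (upTo (rsz S i)))
      Porder   : ∀ z → P z ↭ filterᵇ (occursWith true z) allClauses
      Norder   : ∀ z → N z ↭ filterᵇ (occursWith false z) allClauses

module Submission where

open import Defs
open import Data.Nat using (ℕ; zero; suc; _+_; _*_; _≤_; _<_; z≤n; s≤s; _≡ᵇ_; _≤ᵇ_)
open import Data.Nat.Properties using (+-assoc; +-comm; +-identityʳ; *-zeroʳ; *-suc; *-distribˡ-+; *-identityˡ; *-comm; *-assoc; +-mono-≤; +-monoˡ-≤; +-monoʳ-≤; *-monoˡ-≤; *-monoʳ-≤; ≤-refl; ≤-trans; ≤-reflexive; <-irrefl; ≤-pred; m≤n+m; m≤n⇒m<n∨m≡n; ≡ᵇ⇒≡; ≤ᵇ⇒≤; module ≤-Reasoning)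
open import Data.Nat.DivMod using (_/_; m*n/n≡m)
open import Data.Nat.Divisibility using (_∣_; divides; ∣m∣n⇒∣m+n; m∣m*n)
open import Data.Nat.Tactic.RingSolver using (solve-∀)
open import Data.Integer using (+_; +≤+)
import Data.Integer as ℤ
import Data.Integer.Properties as ℤP
open import Data.Integer.Tactic.RingSolver using () renaming (solve-∀ to ℤ-solve-∀)
open import Data.Rational using (ℚ; toℚᵘ) renaming (_/_ to _/ℚ_; _+_ to _+ℚ_; _*_ to _*ℚ_; _≤_ to _≤ℚ_)
import Data.Rational.Properties as ℚP
open import Data.Rational.Unnormalised using (mkℚᵘ; *≡*; *≤*) renaming (_≃_ to _≃ᵘ_)
import Data.Rational.Unnormalised.Properties as ℚᵘP
open import Data.Fin using (Fin; toℕ) renaming (zero to f0; suc to fs)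
open import Data.Fin.Properties using (toℕ-injective) renaming (_≟_ to _≟F_)
open import Data.Bool using (Bool; true; false; if_then_else_; not; _∧_; _∨_; T)
open import Data.Bool.Properties using (∧-identityʳ; ∧-zeroʳ)
open import Data.Unit using (⊤; tt)
open import Data.Empty using (⊥-elim)
open import Data.Product using (Σ; _×_; _,_; proj₁; proj₂)
open import Data.Sum using (_⊎_; inj₁; inj₂)
open import Data.List using (List; []; _∷_; _++_; map; concatMap; upTo; allFin; filterᵇ; length; tabulate; lookup; cartesianProduct)
open import Data.List.Properties using (map-++; map-tabulate; upTo-∷ʳ; length-++; length-map; length-tabulate; length-upTo)
open import Data.List.Membership.Propositional using (_∈_; lose; find)
open import Data.List.Membership.Propositional.Properties using (∈-++⁺ˡ; ∈-++⁺ʳ; ∈-++⁻; ∈-map⁺; ∈-map⁻; ∈-upTo⁺; ∈-upTo⁻; ∈-allFin; ∈-concatMap⁺; ∈-concatMap⁻)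
open import Data.List.Relation.Unary.Any using (here; there)
open import Data.List.Relation.Unary.All using (All; []; _∷_) renaming (lookup to All-lookup; tabulate to All-tabulate)
open import Data.List.Relation.Unary.All.Properties using (++⁺; concat⁺; map⁺)
open import Data.List.Relation.Unary.AllPairs using (AllPairs; []; _∷_)
open import Data.List.Relation.Binary.Permutation.Propositional using (_↭_; prep; swap; ↭-sym) renaming (refl to perm-refl; trans to perm-trans)
open import Data.List.Relation.Binary.Permutation.Propositional.Properties using (∈-resp-↭)
open import Relation.Binary.Construct.Closure.ReflexiveTransitive using (Star; ε; _◅_; _◅◅_; reverse; gmap)
open import Relation.Binary.PropositionalEquality using (_≡_; _≢_; refl; sym; trans; cong; cong₂; subst; subst₂)
open import Relation.Nullary using (yes; no)
open import Relation.Nullary.Decidable using (⌊_⌋)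

-- Replace σ on the auxiliary variables by the values that are optimal for each
-- equation gadget (auxOpt), obtaining σ⁺.  The tour uses every forced edge once;
-- for every variable z it walks, once, the path of z (True or False) whose
-- literal σ⁺ makes true; and for every clause C without a true literal under σ⁺
-- ("dead") it doubles, on both paths of the main variable of C, the edge
-- entering the occurrence vertex of C.  Then
--  * degrees are even: every path edge is used b + 2·(even surplus) times, and
--    exactly one of the two paths of z has b = 1 (path-parity);
--  * the tour is connected: each occurrence vertex lies on the walked path of a
--    true literal, or in a dead clause whose entering edge is doubled (reach-main);
--  * all weights are multiples of 1/20, so the cost is computed in ℕ: by double
--    counting, the path edges cost 20 · Σ_C charge(#true literals of C), which the
--    gadget lemma bounds by 20 · (#clauses + #unsatisfied clauses), and the
--    remaining fixed cost is 1836 m twentieths, using Σ_i d(i) = 3m, 0.8 d(i)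
--    checker variables and 4 d(i) checker clauses per variable x_i.

ind : Bool → ℕ
ind b = if b then 1 else 0

∑ : {I : Set} → List I → (I → ℕ) → ℕ
∑ xs f = sumℕ (map f xs)

∑-++ : {I : Set} (xs ys : List I) (f : I → ℕ) → ∑ (xs ++ ys) f ≡ ∑ xs f + ∑ ys f
∑-++ [] ys f = refl
∑-++ (x ∷ xs) ys f = trans (cong (_+_ (f x)) (∑-++ xs ys f)) (sym (+-assoc (f x) _ _))

∑-concatMap : {I J : Set} (g : I → List J) (xs : List I) (f : J → ℕ) →
              ∑ (concatMap g xs) f ≡ ∑ xs (λ x → ∑ (g x) f)
∑-concatMap g [] f = refl
∑-concatMap g (x ∷ xs) f = trans (∑-++ (g x) (concatMap g xs) f) (cong (_+_ (∑ (g x) f)) (∑-concatMap g xs f))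

∑-map : {I J : Set} (h : I → J) (xs : List I) (f : J → ℕ) → ∑ (map h xs) f ≡ ∑ xs (λ x → f (h x))
∑-map h [] f = refl
∑-map h (x ∷ xs) f = cong (_+_ (f (h x))) (∑-map h xs f)

∑-cong : {I : Set} (xs : List I) {f g : I → ℕ} → (∀ x → x ∈ xs → f x ≡ g x) → ∑ xs f ≡ ∑ xs g
∑-cong [] e = refl
∑-cong (x ∷ xs) e = cong₂ _+_ (e x (here refl)) (∑-cong xs (λ y p → e y (there p)))

∑-mono : {I : Set} (xs : List I) {f g : I → ℕ} → (∀ x → x ∈ xs → f x ≤ g x) → ∑ xs f ≤ ∑ xs g
∑-mono [] e = z≤n
∑-mono (x ∷ xs) e = +-mono-≤ (e x (here refl)) (∑-mono xs (λ y p → e y (there p)))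

∑-zero : {I : Set} (xs : List I) (f : I → ℕ) → (∀ x → x ∈ xs → f x ≡ 0) → ∑ xs f ≡ 0
∑-zero [] f h = refl
∑-zero (x ∷ xs) f h = cong₂ _+_ (h x (here refl)) (∑-zero xs f (λ y p → h y (there p)))

∑-+ : {I : Set} (xs : List I) (f g : I → ℕ) → ∑ xs (λ x → f x + g x) ≡ ∑ xs f + ∑ xs g
∑-+ [] f g = refl
∑-+ (x ∷ xs) f g = trans (cong (_+_ (f x + g x)) (∑-+ xs f g)) (interchange (f x) (g x) _ _)
  where
  interchange : ∀ a b c d → a + b + (c + d) ≡ a + c + (b + d)
  interchange = solve-∀

∑-*ˡ : {I : Set} (xs : List I) (c : ℕ) (f : I → ℕ) → ∑ xs (λ x → c * f x) ≡ c * ∑ xs f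
∑-*ˡ [] c f = sym (*-zeroʳ c)
∑-*ˡ (x ∷ xs) c f = trans (cong (_+_ (c * f x)) (∑-*ˡ xs c f)) (sym (*-distribˡ-+ c (f x) _))

∑-const : {I : Set} (xs : List I) (c : ℕ) → ∑ xs (λ _ → c) ≡ c * length xs
∑-const [] c = sym (*-zeroʳ c)
∑-const (x ∷ xs) c = trans (cong (_+_ c) (∑-const xs c)) (sym (*-suc c (length xs)))

∑-swap : {I J : Set} (xs : List I) (ys : List J) (F : I → J → ℕ) →
         ∑ xs (λ x → ∑ ys (F x)) ≡ ∑ ys (λ y → ∑ xs (λ x → F x y))
∑-swap [] ys F = sym (∑-zero ys _ (λ _ _ → refl))
∑-swap (x ∷ xs) ys F = trans (cong (_+_ (∑ ys (F x))) (∑-swap xs ys F))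
                             (sym (∑-+ ys (F x) (λ y → ∑ xs (λ x' → F x' y))))

∑-↭ : {I : Set} {xs ys : List I} (f : I → ℕ) → xs ↭ ys → ∑ xs f ≡ ∑ ys f
∑-↭ f perm-refl = refl
∑-↭ f (prep x p) = cong (_+_ (f x)) (∑-↭ f p)
∑-↭ f (swap x y p) = trans (sym (+-assoc (f x) (f y) _))
  (trans (cong₂ _+_ (+-comm (f x) (f y)) (∑-↭ f p)) (+-assoc (f y) (f x) _))
∑-↭ f (perm-trans p q) = trans (∑-↭ f p) (∑-↭ f q)

∑-filter : {I : Set} (p : I → Bool) (xs : List I) (f : I → ℕ) →
           ∑ (filterᵇ p xs) f ≡ ∑ xs (λ x → if p x then f x else 0)
∑-filter p [] f = refl
∑-filter p (x ∷ xs) f with p x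
... | true = cong (_+_ (f x)) (∑-filter p xs f)
... | false = ∑-filter p xs f

∑-even : {I : Set} (xs : List I) (f : I → ℕ) → (∀ x → x ∈ xs → 2 ∣ f x) → 2 ∣ ∑ xs f
∑-even [] f e = divides 0 refl
∑-even (x ∷ xs) f e = ∣m∣n⇒∣m+n (e x (here refl)) (∑-even xs f (λ y p → e y (there p)))

countB-∑ : {I : Set} (p : I → Bool) (xs : List I) → countB p xs ≡ ∑ xs (λ x → ind (p x))
countB-∑ p [] = refl
countB-∑ p (x ∷ xs) = cong (_+_ (ind (p x))) (countB-∑ p xs)

length-filterᵇ : {I : Set} (p : I → Bool) (xs : List I) → length (filterᵇ p xs) ≡ countB p xs
length-filterᵇ p [] = refl
length-filterᵇ p (x ∷ xs) with p x
... | true = cong suc (length-filterᵇ p xs)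
... | false = length-filterᵇ p xs

length-allFin : ∀ k → length (allFin k) ≡ k
length-allFin k = length-tabulate {n = k} (λ x → x)

length-cartesianProduct : {I J : Set} (xs : List I) (ys : List J) →
                          length (cartesianProduct xs ys) ≡ length xs * length ys
length-cartesianProduct [] ys = refl
length-cartesianProduct (x ∷ xs) ys =
  trans (length-++ (map (x ,_) ys)) (cong₂ _+_ (length-map (x ,_) ys) (length-cartesianProduct xs ys))

≡ᵇ-sound : ∀ {a b} → (a ≡ᵇ b) ≡ true → a ≡ b
≡ᵇ-sound {a} {b} e = ≡ᵇ⇒≡ a b (subst T (sym e) tt)

≡ᵇ-refl : ∀ a → (a ≡ᵇ a) ≡ true
≡ᵇ-refl zero = refl
≡ᵇ-refl (suc a) = ≡ᵇ-refl a

∧-true : ∀ {a b} → (a ∧ b) ≡ true → a ≡ true × b ≡ true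
∧-true {true} {true} refl = refl , refl

eqF-sound : ∀ {k} {i j : Fin k} → eqF i j ≡ true → i ≡ j
eqF-sound e = toℕ-injective (≡ᵇ-sound e)

eqF-refl : ∀ {k} (i : Fin k) → eqF i i ≡ true
eqF-refl i = ≡ᵇ-refl (toℕ i)

⌊≟F⌋≡eqF : ∀ {k} (i j : Fin k) → ⌊ i ≟F j ⌋ ≡ eqF i j
⌊≟F⌋≡eqF i j with i ≟F j
... | yes refl = sym (eqF-refl i)
... | no i≢j with eqF i j in e
...   | true = ⊥-elim (i≢j (eqF-sound e))
...   | false = refl

eqV3-sound : ∀ {n m} {a b : V3 n m} → eqV3 a b ≡ true → a ≡ b
eqV3-sound {a = X i j} {X i' j'} e = let p , q = ∧-true {eqF i i'} e in cong₂ X (eqF-sound p) (≡ᵇ-sound q)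
eqV3-sound {a = Y i j} {Y i' j'} e = let p , q = ∧-true {eqF i i'} e in cong₂ Y (eqF-sound p) (≡ᵇ-sound q)
eqV3-sound {a = A l t} {A l' t'} e = let p , q = ∧-true {eqF l l'} e in cong₂ A (eqF-sound p) (eqF-sound q)

eqV3-refl : ∀ {n m} (a : V3 n m) → eqV3 a a ≡ true
eqV3-refl (X i j) rewrite eqF-refl i = ≡ᵇ-refl j
eqV3-refl (Y i j) rewrite eqF-refl i = ≡ᵇ-refl j
eqV3-refl (A l t) rewrite eqF-refl l = eqF-refl t

anyB-intro : {I : Set} (p : I → Bool) {x : I} (xs : List I) → x ∈ xs → p x ≡ true → anyB p xs ≡ true
anyB-intro p (y ∷ xs) (here refl) e rewrite e = refl
anyB-intro p (y ∷ xs) (there q) e with p y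
... | true = refl
... | false = anyB-intro p xs q e

anyB-witness : {I : Set} (p : I → Bool) (xs : List I) → anyB p xs ≡ true → Σ I λ x → x ∈ xs × p x ≡ true
anyB-witness p (y ∷ xs) e with p y in py
... | true = y , here refl , py
... | false = let x , x∈ , px = anyB-witness p xs e in x , there x∈ , px

countB-witness : {I : Set} (p : I → Bool) (xs : List I) → (countB p xs ≡ᵇ 0) ≡ false →
                 Σ I λ x → x ∈ xs × p x ≡ true
countB-witness p (y ∷ xs) e with p y in py
... | true = y , here refl , py
... | false = let x , x∈ , px = countB-witness p xs e in x , there x∈ , px

-- allFin (suc k) = f0 ∷ map fs (allFin k), seen through a sum.
∑-allFin-suc : ∀ {k} (h : Fin (suc k) → ℕ) → ∑ (tabulate {n = k} fs) h ≡ ∑ (allFin k) (λ i → h (fs i))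
∑-allFin-suc h = cong sumℕ (trans (map-tabulate fs h) (sym (map-tabulate (λ x → x) (λ i → h (fs i)))))

∑-select-Fin : ∀ {k} (i₀ : Fin k) (K : Fin k → ℕ) → ∑ (allFin k) (λ i → if eqF i₀ i then K i else 0) ≡ K i₀
∑-select-Fin {suc k} f0 K =
  trans (cong (_+_ (K f0)) (trans (∑-allFin-suc {k} _) (∑-zero (allFin k) _ (λ _ _ → refl)))) (+-identityʳ (K f0))
∑-select-Fin {suc k} (fs i₀) K = trans (∑-allFin-suc {k} _) (∑-select-Fin i₀ (λ i → K (fs i)))

∑-select-upTo : ∀ d j₀ → j₀ < d → (K : ℕ → ℕ) → ∑ (upTo d) (λ j → if j₀ ≡ᵇ j then K j else 0) ≡ K j₀
∑-select-upTo (suc d) j₀ j₀<1+d K =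
  trans (cong (λ xs → ∑ xs h) (sym (upTo-∷ʳ d)))
        (trans (∑-++ (upTo d) (d ∷ []) h) (lastOrNot (m≤n⇒m<n∨m≡n (≤-pred j₀<1+d))))
  where
  h : ℕ → ℕ
  h j = if j₀ ≡ᵇ j then K j else 0
  -- upTo (1 + d) = upTo d ++ [d]; the selected index is in upTo d or is d.
  lastOrNot : j₀ < d ⊎ j₀ ≡ d → ∑ (upTo d) h + (h d + 0) ≡ K j₀
  lastOrNot (inj₁ j₀<d) with j₀ ≡ᵇ d in e
  ... | true = ⊥-elim (<-irrefl (≡ᵇ-sound e) j₀<d)
  ... | false = trans (+-identityʳ _) (∑-select-upTo d j₀ j₀<d K)
  lastOrNot (inj₂ refl) =
    trans (cong₂ _+_ (∑-zero (upTo d) h (λ j p → below j (∈-upTo⁻ p))) (cong (λ b → (if b then K j₀ else 0) + 0) (≡ᵇ-refl j₀)))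
          (+-identityʳ (K j₀))
    where
    below : ∀ j → j < j₀ → h j ≡ 0
    below j j<j₀ with j₀ ≡ᵇ j in e
    ... | true = ⊥-elim (<-irrefl (sym (≡ᵇ-sound e)) j<j₀)
    ... | false = refl

∈-concatMap-intro : {I J : Set} (g : I → List J) {xs : List I} {x : I} {y : J} → x ∈ xs → y ∈ g x → y ∈ concatMap g xs
∈-concatMap-intro g x∈ y∈ = ∈-concatMap⁺ g (lose x∈ y∈)

∈-concatMap-elim : {I J : Set} (g : I → List J) (xs : List I) {y : J} → y ∈ concatMap g xs → Σ I λ x → x ∈ xs × y ∈ g x
∈-concatMap-elim g xs y∈ = find (∈-concatMap⁻ g {xs = xs} y∈)

∈-filterᵇ-intro : {I : Set} (p : I → Bool) (xs : List I) {x : I} → x ∈ xs → p x ≡ true → x ∈ filterᵇ p xs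
∈-filterᵇ-intro p (y ∷ xs) (here refl) px with p y
∈-filterᵇ-intro p (y ∷ xs) (here refl) refl | true = here refl
∈-filterᵇ-intro p (y ∷ xs) (there x∈) px with p y
... | true = there (∈-filterᵇ-intro p xs x∈ px)
... | false = ∈-filterᵇ-intro p xs x∈ px

∈-filterᵇ-elim : {I : Set} (p : I → Bool) (xs : List I) {x : I} → x ∈ filterᵇ p xs → x ∈ xs × p x ≡ true
∈-filterᵇ-elim p (y ∷ xs) x∈ with p y in py
∈-filterᵇ-elim p (y ∷ xs) (here refl) | true = here refl , py
∈-filterᵇ-elim p (y ∷ xs) (there x∈) | true = let x∈xs , px = ∈-filterᵇ-elim p xs x∈ in there x∈xs , px
∈-filterᵇ-elim p (y ∷ xs) x∈ | false = let x∈xs , px = ∈-filterᵇ-elim p xs x∈ in there x∈xs , px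

All-concatMap : {I J : Set} {Q : J → Set} (g : I → List J) (xs : List I) → (∀ x → All Q (g x)) → All Q (concatMap g xs)
All-concatMap g xs h = concat⁺ (map⁺ {xs = xs} (All-tabulate (λ {x} _ → h x)))

-- A boolean property of booleans holds everywhere once it holds at both values;
-- `every` lets finite case analyses be discharged by evaluation.
every : (Bool → Bool) → Bool
every p = p true ∧ p false

every-sound : (p : Bool → Bool) → every p ≡ true → ∀ b → p b ≡ true
every-sound p h true = proj₁ (∧-true h)
every-sound p h false = proj₂ (∧-true {p true} h)

every⁶ : (Bool → Bool → Bool → Bool → Bool → Bool → Bool) → Bool
every⁶ P = every λ a → every λ b → every λ c → every λ d → every λ e → every λ f → P a b c d e f

every⁶-sound : ∀ P → every⁶ P ≡ true → ∀ a b c d e f → P a b c d e f ≡ true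
every⁶-sound P h a b c d e f =
  every-sound (P a b c d e) (every-sound (λ e → every (P a b c d e))
    (every-sound (λ d → every λ e → every (P a b c d e)) (every-sound (λ c → every λ d → every λ e → every (P a b c d e))
      (every-sound (λ b → every λ c → every λ d → every λ e → every (P a b c d e))
        (every-sound (λ a → every λ b → every λ c → every λ d → every λ e → every (P a b c d e)) h a) b) c) d) e) f

-- What a clause with t true literals costs the tour (in path edges, each of
-- weight 1): one edge per true literal, or a doubled edge if there is none.
charge : ℕ → ℕ
charge t = t + 2 * ind (t ≡ᵇ 0)

-- What the bound allows for a clause with t true literals: 1, plus 1 if unsatisfied.
allowance : ℕ → ℕ
allowance t = 1 + ind (not (t ≡ᵇ 1))

count3 : Bool → Bool → Bool → ℕ
count3 a b c = ind a + (ind b + (ind c + 0))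

-- Best auxiliary values (a₁,a₂,a₃) for the gadget (λ ∨ a₁ ∨ a₂), (x₂ ∨ a₂ ∨ a₃),
-- (x₃ ∨ a₁ ∨ a₃) when the main literals λ, x₂, x₃ have values a, b, c.
auxOpt : Bool → Bool → Bool → Fin 3 → Bool
auxOpt a b c f0 = not a ∧ b ∧ not c
auxOpt a b c (fs f0) = not a ∧ not b ∧ c
auxOpt a b c (fs (fs f0)) = not (b ∨ c)

gadgetCharge : Bool → Bool → Bool → ℕ
gadgetCharge a b c = charge (count3 a (o f0) (o (fs f0)))
                   + (charge (count3 b (o (fs f0)) (o (fs (fs f0))))
                   + (charge (count3 c (o f0) (o (fs (fs f0)))) + 0))
  where
  o : Fin 3 → Bool
  o = auxOpt a b c

gadgetAllowance : Bool → Bool → Bool → Bool → Bool → Bool → ℕ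
gadgetAllowance a b c a₁ a₂ a₃ =
  allowance (count3 a a₁ a₂) + (allowance (count3 b a₂ a₃) + (allowance (count3 c a₁ a₃) + 0))

-- Gadget lemma: with the optimal auxiliary values, the charge of an equation
-- gadget is within the allowance of any assignment agreeing on the main literals.
gadget-lemma : ∀ a b c a₁ a₂ a₃ → gadgetCharge a b c ≤ gadgetAllowance a b c a₁ a₂ a₃
gadget-lemma a b c a₁ a₂ a₃ =
  ≤ᵇ⇒≤ _ _ (subst T (sym (every⁶-sound check refl a b c a₁ a₂ a₃)) tt)
  where
  check : Bool → Bool → Bool → Bool → Bool → Bool → Bool
  check a b c a₁ a₂ a₃ = gadgetCharge a b c ≤ᵇ gadgetAllowance a b c a₁ a₂ a₃

clause2-lemma : ∀ a b → charge (ind a + (ind b + 0)) ≤ allowance (ind a + (ind b + 0))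
clause2-lemma true true = ≤-refl
clause2-lemma true false = ≤-refl
clause2-lemma false true = ≤-refl
clause2-lemma false false = ≤-refl

-- All weights of G are multiples of 1/20.  An entry is an edge of G together
-- with the multiplicity the tour gives it and its weight in twentieths.
record Entry (n m : ℕ) : Set where
  constructor entry
  field
    edgeOf : Edge n m
    mult   : ℕ
    w20    : ℕ
open Entry public

ι : ℕ → ℚ
ι k = + k /ℚ 1

WeightOK : {n m : ℕ} → Entry n m → Set
WeightOK x = toℚᵘ (ew (edgeOf x)) ≃ᵘ mkℚᵘ (+ w20 x) 19

cost-twentieths : ∀ {n m : ℕ} (L : List (Entry n m)) → All WeightOK L →
                  toℚᵘ (sumℚ (map (λ x → ι (mult x) *ℚ ew (edgeOf x)) L)) ≃ᵘ mkℚᵘ (+ ∑ L (λ x → mult x * w20 x)) 19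
cost-twentieths [] [] = *≡* refl
cost-twentieths (x ∷ L) (wx ∷ wL) =
  ℚᵘP.≃-trans (ℚP.toℚᵘ-homo-+ (ι (mult x) *ℚ ew (edgeOf x)) _)
  (ℚᵘP.≃-trans (ℚᵘP.+-cong (ℚᵘP.≃-trans (ℚP.toℚᵘ-homo-* (ι (mult x)) _) (ℚᵘP.*-cong (ℚP.toℚᵘ-fromℚᵘ (mkℚᵘ (+ mult x) 0)) wx))
                           (cost-twentieths L wL))
  (*≡* (trans (sameDenominator (+ mult x ℤ.* + w20 x) (+ ∑ L (λ x → mult x * w20 x)))
              (cong (ℤ._* + 400) (trans (cong (ℤ._+ _) (sym (ℤP.pos-* (mult x) (w20 x)))) (sym (ℤP.pos-+ (mult x * w20 x) (∑ L (λ x → mult x * w20 x)))))))))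
  where
  sameDenominator : ∀ a b → (a ℤ.* + 20 ℤ.+ b ℤ.* + 20) ℤ.* + 20 ≡ (a ℤ.+ b) ℤ.* + 400
  sameDenominator = ℤ-solve-∀

twentieths-bound : ∀ (N M k : ℕ) → N ≤ 1836 * M + 20 * k → (q : ℚ) → toℚᵘ q ≃ᵘ mkℚᵘ (+ N) 19 →
                   q ≤ℚ (+ (459 * M) /ℚ 5) +ℚ (+ k /ℚ 1)
twentieths-bound N M k N≤ q q≃ = ℚP.toℚᵘ-cancel-≤ (ℚᵘP.≤-respˡ-≃ (ℚᵘP.≃-sym q≃)
  (ℚᵘP.≤-respʳ-≃ (ℚᵘP.≃-sym (ℚᵘP.≃-trans (ℚP.toℚᵘ-homo-+ (+ (459 * M) /ℚ 5) (+ k /ℚ 1))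
                     (ℚᵘP.+-cong (ℚP.toℚᵘ-fromℚᵘ (mkℚᵘ (+ (459 * M)) 4)) (ℚP.toℚᵘ-fromℚᵘ (mkℚᵘ (+ k) 0)))))
     (*≤* (subst₂ ℤ._≤_ (ℤP.pos-* N 5) lhs≡ (+≤+ cross)))))
  where
  cross : N * 5 ≤ (459 * M * 1 + k * 5) * 20
  cross = ≤-trans (*-monoˡ-≤ 5 N≤) (≤-reflexive (rearrange M k))
    where
    rearrange : ∀ M k → (1836 * M + 20 * k) * 5 ≡ (459 * M * 1 + k * 5) * 20
    rearrange = solve-∀
  lhs≡ : + ((459 * M * 1 + k * 5) * 20) ≡ (+ (459 * M) ℤ.* + 1 ℤ.+ + k ℤ.* + 5) ℤ.* + 20
  lhs≡ = trans (ℤP.pos-* (459 * M * 1 + k * 5) 20)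
               (cong (ℤ._* + 20) (trans (ℤP.pos-+ (459 * M * 1) (k * 5)) (cong₂ ℤ._+_ (ℤP.pos-* (459 * M) 1) (ℤP.pos-* k 5))))

module _ {n m : ℕ} where

  -- The tour conditions for an arbitrary edge list es and vertex list vs; for
  -- es = edgesG and vs = verticesG these are definitionally those of Defs.
  incidence : Vtx n m → Edge n m → ℕ
  incidence v d = (if eqVtx (eu d) v then 1 else 0) + (if eqVtx (ev d) v then 1 else 0)

  AdjOn : (es : List (Edge n m)) → (Fin (length es) → ℕ) → Vtx n m → Vtx n m → Set
  AdjOn es μ u v = Σ (Fin (length es)) λ e →
    1 ≤ μ e × ((eu (lookup es e) ≡ u × ev (lookup es e) ≡ v) ⊎ (eu (lookup es e) ≡ v × ev (lookup es e) ≡ u))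

  IsTourOn : (es : List (Edge n m)) (vs : List (Vtx n m)) → (Fin (length es) → ℕ) → Set
  IsTourOn es vs μ =
    (∀ e → forced (lookup es e) ≡ true → 1 ≤ μ e)
    × (∀ v → 2 ∣ sumℕ (map (λ e → μ e * incidence v (lookup es e)) (allFin (length es))))
    × (∀ u v → u ∈ vs → v ∈ vs → Star (AdjOn es μ) u v)

  costOn : (es : List (Edge n m)) → (Fin (length es) → ℕ) → ℚ
  costOn es μ = sumℚ (map (λ e → (+ μ e /ℚ 1) *ℚ ew (lookup es e)) (allFin (length es)))

  Link : List (Entry n m) → Vtx n m → Vtx n m → Set
  Link L u v = Σ (Entry n m) λ x →
    x ∈ L × 1 ≤ mult x × ((eu (edgeOf x) ≡ u × ev (edgeOf x) ≡ v) ⊎ (eu (edgeOf x) ≡ v × ev (edgeOf x) ≡ u))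

  link-sym : ∀ {L u v} → Link L u v → Link L v u
  link-sym (x , x∈ , used , inj₁ (p , q)) = x , x∈ , used , inj₂ (p , q)
  link-sym (x , x∈ , used , inj₂ (p , q)) = x , x∈ , used , inj₁ (p , q)

  multOf : (L : List (Entry n m)) → Fin (length (map edgeOf L)) → ℕ
  multOf (x ∷ L) f0 = mult x
  multOf (x ∷ L) (fs e) = multOf L e

  private
    sum-over-lookup : (L : List (Entry n m)) (h : ℕ → Edge n m → ℕ) →
      sumℕ (map (λ e → h (multOf L e) (lookup (map edgeOf L) e)) (allFin (length (map edgeOf L))))
      ≡ ∑ L (λ x → h (mult x) (edgeOf x))
    sum-over-lookup L h = trans (cong sumℕ (map-tabulate {n = length (map edgeOf L)} (λ x → x) _)) (go L)
      where
      go : (L : List (Entry n m)) → sumℕ (tabulate (λ e → h (multOf L e) (lookup (map edgeOf L) e))) ≡ ∑ L (λ x → h (mult x) (edgeOf x))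
      go [] = refl
      go (x ∷ L) = cong (λ t → h (mult x) (edgeOf x) + t) (go L)

    sumℚ-over-lookup : (L : List (Entry n m)) (h : ℕ → Edge n m → ℚ) →
      sumℚ (map (λ e → h (multOf L e) (lookup (map edgeOf L) e)) (allFin (length (map edgeOf L))))
      ≡ sumℚ (map (λ x → h (mult x) (edgeOf x)) L)
    sumℚ-over-lookup L h = trans (cong sumℚ (map-tabulate {n = length (map edgeOf L)} (λ x → x) _)) (go L)
      where
      go : (L : List (Entry n m)) → sumℚ (tabulate (λ e → h (multOf L e) (lookup (map edgeOf L) e))) ≡ sumℚ (map (λ x → h (mult x) (edgeOf x)) L)
      go [] = refl
      go (x ∷ L) = cong (h (mult x) (edgeOf x) +ℚ_) (go L)

    forced-lookup : (L : List (Entry n m)) → (∀ x → x ∈ L → forced (edgeOf x) ≡ true → 1 ≤ mult x) →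
                    ∀ e → forced (lookup (map edgeOf L) e) ≡ true → 1 ≤ multOf L e
    forced-lookup (x ∷ L) h f0 fe = h x (here refl) fe
    forced-lookup (x ∷ L) h (fs e) fe = forced-lookup L (λ y p → h y (there p)) e fe

    link-lookup : (L : List (Entry n m)) {u v : Vtx n m} → Link L u v → AdjOn (map edgeOf L) (multOf L) u v
    link-lookup (x ∷ L) (x , here refl , used , ends) = f0 , used , ends
    link-lookup (y ∷ L) (x , there x∈ , used , ends) =
      let e , used′ , ends′ = link-lookup L (x , x∈ , used , ends) in fs e , used′ , ends′

  tour-from-entries : (L : List (Entry n m)) (vs : List (Vtx n m)) (bound : ℚ) →
    (∀ x → x ∈ L → forced (edgeOf x) ≡ true → 1 ≤ mult x) →
    (∀ v → 2 ∣ ∑ L (λ x → mult x * incidence v (edgeOf x))) →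
    (∀ u v → u ∈ vs → v ∈ vs → Star (Link L) u v) →
    sumℚ (map (λ x → ι (mult x) *ℚ ew (edgeOf x)) L) ≤ℚ bound →
    (es : List (Edge n m)) → map edgeOf L ≡ es →
    Σ (Fin (length es) → ℕ) (λ μ → IsTourOn es vs μ × costOn es μ ≤ℚ bound)
  tour-from-entries L vs bound forcedUsed even linked costBound .(map edgeOf L) refl =
    multOf L ,
    (forced-lookup L forcedUsed ,
     (λ v → subst (2 ∣_) (sym (sum-over-lookup L (λ k d → k * incidence v d))) (even v)) ,
     (λ u v u∈ v∈ → gmap (λ w → w) (link-lookup L) (linked u v u∈ v∈))) ,
    subst (_≤ℚ bound) (sym (sumℚ-over-lookup L (λ k d → ι k *ℚ ew d))) costBound

∣-resp-≡ : ∀ {d a b} → a ≡ b → d ∣ b → d ∣ a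
∣-resp-≡ {d} a≡b = subst (d ∣_) (sym a≡b)

module _ {n m : ℕ} where

  -- The entries of a path u₀ u₁ … uₖ of weight-1 (= 20 twentieths) non-forced
  -- edges, where the edge entering uᵢ is used b + 2·g(uᵢ) times.
  pathEntries : ℕ → (Vtx n m → ℕ) → List (Vtx n m) → List (Entry n m)
  pathEntries b g (u ∷ v ∷ rest) = entry (edge u v (+ 1 /ℚ 1) false) (b + 2 * g v) 20 ∷ pathEntries b g (v ∷ rest)
  pathEntries b g _ = []

  pathEntries-unforced : ∀ b g vs x → x ∈ pathEntries b g vs → forced (edgeOf x) ≡ false
  pathEntries-unforced b g (u ∷ v ∷ r) x (here refl) = refl
  pathEntries-unforced b g (u ∷ v ∷ r) x (there p) = pathEntries-unforced b g (v ∷ r) x p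

  degreeIn : List (Entry n m) → Vtx n m → ℕ
  degreeIn L v = ∑ L (λ x → mult x * incidence v (edgeOf x))

  isAt : Vtx n m → Vtx n m → ℕ
  isAt v w = ind (eqVtx w v)

  -- Parity of a path: inner vertices get even degree, the two ends get degree
  -- ≡ b (mod 2), since each edge is used b times plus an even surplus.
  path-parity : ∀ v b g u xs t → 2 ∣ degreeIn (pathEntries b g (u ∷ (xs ++ t ∷ []))) v + b * (isAt v u + isAt v t)
  path-parity v b g u [] t = ∣-resp-≡ (oneEdge b (g t) (isAt v u + isAt v t)) (m∣m*n ((b + g t) * (isAt v u + isAt v t)))
    where
    oneEdge : ∀ b g E → (b + 2 * g) * E + 0 + b * E ≡ 2 * ((b + g) * E)
    oneEdge = solve-∀
  path-parity v b g u (w ∷ xs) t =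
    ∣-resp-≡ (firstEdge b (g w) (isAt v u) (isAt v w) (isAt v t) (degreeIn (pathEntries b g (w ∷ (xs ++ t ∷ []))) v))
             (∣m∣n⇒∣m+n (path-parity v b g w xs t) (m∣m*n (b * isAt v u + g w * (isAt v u + isAt v w))))
    where
    firstEdge : ∀ b g eu ew et D → (b + 2 * g) * (eu + ew) + D + b * (eu + et) ≡ (D + b * (ew + et)) + 2 * (b * eu + g * (eu + ew))
    firstEdge = solve-∀

  path-cost : ∀ b g u xs → ∑ (pathEntries b g (u ∷ xs)) (λ x → mult x * w20 x) ≡ 20 * ∑ xs (λ w → b + 2 * g w)
  path-cost b g u [] = refl
  path-cost b g u (v ∷ r) =
    trans (cong (λ r → (b + 2 * g v) * 20 + r) (path-cost b g v r)) (factor (b + 2 * g v) (∑ r (λ w → b + 2 * g w)))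
    where
    factor : ∀ a t → a * 20 + 20 * t ≡ 20 * (a + t)
    factor = solve-∀

  path-reach : (L : List (Entry n m)) (t : Vtx n m) (b : ℕ) (g : Vtx n m → ℕ) (u : Vtx n m) (rest : List (Vtx n m)) →
    (∀ x → x ∈ pathEntries b g (u ∷ rest) → x ∈ L) → Star (Link L) u t →
    (∀ w → w ∈ rest → Star (Link L) w t ⊎ 1 ≤ b + 2 * g w) → ∀ w → w ∈ rest → Star (Link L) w t
  path-reach L t b g u (v ∷ r) sub u↝t step w w∈ = along w∈
    where
    v↝t : Star (Link L) v t
    v↝t with step v (here refl)
    ... | inj₁ reached = reached
    ... | inj₂ used = (entry (edge u v (+ 1 /ℚ 1) false) (b + 2 * g v) 20 , sub _ (here refl) , used , inj₂ (refl , refl)) ◅ u↝t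
    along : w ∈ v ∷ r → Star (Link L) w t
    along (here refl) = v↝t
    along (there w∈r) = path-reach L t b g v r (λ x p → sub x (there p)) v↝t (λ w′ p → step w′ (there p)) w w∈r

-- Degree arithmetic for the gadgets: a doubled edge and a triangle contribute
-- even degree, and so do two terminal edges together with two paths of which
-- exactly one (selected by b) has base multiplicity 1.
double-edge-degree : ∀ a b → 1 * (a + b) + (1 * (a + b) + 0) ≡ 2 * (a + b)
double-edge-degree = solve-∀

triangle-degree : ∀ x y w → 1 * (x + y) + (1 * (x + w) + (1 * (y + w) + 0)) ≡ 2 * (x + y + w)
triangle-degree = solve-∀

walked-first : ∀ T F eS eL eR → (1 * (eS + eL) + (1 * (eS + eR) + 0)) + (T + F) ≡ (T + 1 * (eL + eR)) + (F + 0 * (eL + eR)) + 2 * eS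
walked-first = solve-∀

walked-second : ∀ T F eS eL eR → (1 * (eS + eL) + (1 * (eS + eR) + 0)) + (T + F) ≡ (T + 0 * (eL + eR)) + (F + 1 * (eL + eR)) + 2 * eS
walked-second = solve-∀

one-path-walked : ∀ (b : Bool) T F eS eL eR → 2 ∣ T + ind b * (eL + eR) → 2 ∣ F + ind (not b) * (eL + eR) →
                  2 ∣ (1 * (eS + eL) + (1 * (eS + eR) + 0)) + (T + F)
one-path-walked true T F eS eL eR evT evF = ∣-resp-≡ (walked-first T F eS eL eR) (∣m∣n⇒∣m+n (∣m∣n⇒∣m+n evT evF) (m∣m*n eS))
one-path-walked false T F eS eL eR evT evF = ∣-resp-≡ (walked-second T F eS eL eR) (∣m∣n⇒∣m+n (∣m∣n⇒∣m+n evT evF) (m∣m*n eS))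

module _ {n m : ℕ} where

  hasPol : Bool → Lit n m → Bool
  hasPol p l = if lpos l then p else not p

  occurs-as-sum : (ls : List (Lit n m)) → AllPairs (λ l l′ → lv l ≢ lv l′) ls → ∀ z (q : Lit n m → Bool) (G : ℕ) →
    (if anyB (λ l → eqV3 (lv l) z ∧ q l) ls then G else 0) ≡ ∑ ls (λ l → if eqV3 (lv l) z ∧ q l then G else 0)
  occurs-as-sum [] _ z q G = refl
  occurs-as-sum (l ∷ ls) (l≢ls ∷ distinct) z q G with eqV3 (lv l) z ∧ q l in e
  ... | true = sym (trans (cong (_+_ G) (∑-zero ls _ others)) (+-identityʳ G))
    where
    others : ∀ l′ → l′ ∈ ls → (if eqV3 (lv l′) z ∧ q l′ then G else 0) ≡ 0
    others l′ l′∈ with eqV3 (lv l′) z in e′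
    ... | true = ⊥-elim (All-lookup l≢ls l′∈ (trans (eqV3-sound (proj₁ (∧-true {eqV3 (lv l) z} e))) (sym (eqV3-sound e′))))
    ... | false = refl
  ... | false = occurs-as-sum ls distinct z q G

  polarity-split : ∀ (l : Lit n m) (F : Bool → ℕ) → (if hasPol true l then F true else 0) + (if hasPol false l then F false else 0) ≡ F (lpos l)
  polarity-split (lit z true) F = +-identityʳ _
  polarity-split (lit z false) F = refl

module TourFor (S : Sys) (num : Fin (m S) → Fin 3 → ℕ) (H : Fin (n S) → ℕ → ℕ → Bool)
               (P N : V3 (n S) (m S) → List (Cl (n S) (m S)))
               (valid : Construction.Valid S num H P N) (σ : V3 (n S) (m S) → Bool) where
  open Construction S num H
  open Graph P N
  open Valid valid

  En : Set
  En = Entry (n S) (m S)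

  σ⁺ : V → Bool
  σ⁺ (X i j) = σ (X i j)
  σ⁺ (Y i k) = σ (Y i k)
  σ⁺ (A ℓ t) = auxOpt (litVal σ (lit (xo ℓ f0) (rhs S ℓ))) (σ (xo ℓ (fs f0))) (σ (xo ℓ (fs (fs f0)))) t

  trueCount : C → ℕ
  trueCount c = countB (litVal σ⁺) (lits c)

  dead : C → Bool
  dead c = trueCount c ≡ᵇ 0

  -- Main variables x_{(i,j)}: every clause has exactly one main literal.
  isMain : V → Bool
  isMain (X _ _) = true
  isMain _ = false

  surplus : V → W → ℕ
  surplus z (oc _ c) = ind (isMain z ∧ dead c)
  surplus z _ = 0

  order : Bool → V → List C
  order true = P
  order false = N

  base : Bool → V → ℕ
  base p z = ind (if p then σ⁺ z else not (σ⁺ z))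

  pathVertices : V → List C → List W
  pathVertices z L = tL z ∷ (map (oc z) L ++ (tR z ∷ []))

  pathOf : Bool → V → List En
  pathOf p z = pathEntries (base p z) (surplus z) (pathVertices z (order p z))

  -- Forced edges are used once; weights in twentieths.
  terminal20 : V → ℕ
  terminal20 (A _ _) = 10
  terminal20 _ = 35

  terminalEntries : V → List En
  terminalEntries z = entry (edge s (tL z) (wTerm z) true) 1 (terminal20 z)
                    ∷ entry (edge s (tR z) (wTerm z) true) 1 (terminal20 z) ∷ []

  triangleEntries : W → W → W → List En
  triangleEntries z a a′ = entry (edge z a (+ 5 /ℚ 4) true) 1 25 ∷ entry (edge z a′ (+ 5 /ℚ 4) true) 1 25
                         ∷ entry (edge a a′ (+ 1 /ℚ 1) true) 1 20 ∷ []

  clauseEntries : C → List En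
  clauseEntries c@(C2 i j k) = entry (edge (oc (X i j) c) (oc (Y i k) c) (+ 3 /ℚ 2) true) 1 30
                             ∷ entry (edge (oc (X i j) c) (oc (Y i k) c) (+ 3 /ℚ 2) true) 1 30 ∷ []
  clauseEntries c@(C3 ℓ f0) = triangleEntries (oc (xo ℓ f0) c) (oc (A ℓ f0) c) (oc (A ℓ (fs f0)) c)
  clauseEntries c@(C3 ℓ (fs f0)) = triangleEntries (oc (xo ℓ (fs f0)) c) (oc (A ℓ (fs f0)) c) (oc (A ℓ (fs (fs f0))) c)
  clauseEntries c@(C3 ℓ (fs (fs f0))) = triangleEntries (oc (xo ℓ (fs (fs f0))) c) (oc (A ℓ f0) c) (oc (A ℓ (fs (fs f0))) c)

  bothPaths : V → List En
  bothPaths z = pathOf true z ++ pathOf false z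

  -- The tour, listed in the same order as edgesG.
  tourEntries : List En
  tourEntries = concatMap terminalEntries allVars ++ (concatMap clauseEntries allClauses ++ concatMap bothPaths allVars)

  edges-match : map edgeOf tourEntries ≡ edgesG
  edges-match = trans (map-++ edgeOf (concatMap terminalEntries allVars) _)
    (cong₂ _++_ (map-concatMap (λ z → refl) allVars)
      (trans (map-++ edgeOf (concatMap clauseEntries allClauses) _)
        (cong₂ _++_ (map-concatMap clause-match allClauses)
          (map-concatMap (λ z → trans (map-++ edgeOf (pathOf true z) (pathOf false z))
                                      (cong₂ _++_ (path-match (base true z) (surplus z) (pathVertices z (P z)))
                                                  (path-match (base false z) (surplus z) (pathVertices z (N z))))) allVars))))
    where
    map-concatMap : {I : Set} {g : I → List En} {h : I → List (Edge (n S) (m S))} → (∀ x → map edgeOf (g x) ≡ h x) →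
                    (xs : List I) → map edgeOf (concatMap g xs) ≡ concatMap h xs
    map-concatMap e [] = refl
    map-concatMap {g = g} e (x ∷ xs) = trans (map-++ edgeOf (g x) _) (cong₂ _++_ (e x) (map-concatMap e xs))
    path-match : ∀ b g vs → map edgeOf (pathEntries b g vs) ≡ pathEdges vs
    path-match b g [] = refl
    path-match b g (u ∷ []) = refl
    path-match b g (u ∷ v ∷ r) = cong (edge u v (+ 1 /ℚ 1) false ∷_) (path-match b g (v ∷ r))
    clause-match : ∀ c → map edgeOf (clauseEntries c) ≡ clauseEdges c
    clause-match (C2 i j k) = refl
    clause-match (C3 ℓ f0) = refl
    clause-match (C3 ℓ (fs f0)) = refl
    clause-match (C3 ℓ (fs (fs f0))) = refl

  -- Every forced edge is used: forced entries are terminal or clause entries,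
  -- all of multiplicity 1; path entries are not forced.
  forced-used : ∀ x → x ∈ tourEntries → forced (edgeOf x) ≡ true → 1 ≤ mult x
  forced-used x x∈ isForced with ∈-++⁻ (concatMap terminalEntries allVars) x∈
  ... | inj₁ p with ∈-concatMap-elim terminalEntries allVars p
  ...   | z , _ , here refl = s≤s z≤n
  ...   | z , _ , there (here refl) = s≤s z≤n
  forced-used x x∈ isForced | inj₂ p with ∈-++⁻ (concatMap clauseEntries allClauses) p
  ... | inj₁ q with ∈-concatMap-elim clauseEntries allClauses q
  ...   | c , _ , x∈c = ≤-reflexive (sym (clause-once c x∈c))
    where
    clause-once : ∀ c → x ∈ clauseEntries c → mult x ≡ 1
    clause-once (C2 i j k) (here refl) = refl
    clause-once (C2 i j k) (there (here refl)) = refl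
    clause-once (C3 ℓ f0) (here refl) = refl
    clause-once (C3 ℓ f0) (there (here refl)) = refl
    clause-once (C3 ℓ f0) (there (there (here refl))) = refl
    clause-once (C3 ℓ (fs f0)) (here refl) = refl
    clause-once (C3 ℓ (fs f0)) (there (here refl)) = refl
    clause-once (C3 ℓ (fs f0)) (there (there (here refl))) = refl
    clause-once (C3 ℓ (fs (fs f0))) (here refl) = refl
    clause-once (C3 ℓ (fs (fs f0))) (there (here refl)) = refl
    clause-once (C3 ℓ (fs (fs f0))) (there (there (here refl))) = refl
  forced-used x x∈ isForced | inj₂ p | inj₂ q with ∈-concatMap-elim bothPaths allVars q
  ... | z , _ , x∈z with ∈-++⁻ (pathOf true z) x∈z
  ...   | inj₁ r with trans (sym isForced) (pathEntries-unforced _ _ _ x r)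
  ...     | ()
  forced-used x x∈ isForced | inj₂ p | inj₂ q | z , _ , x∈z | inj₂ r with trans (sym isForced) (pathEntries-unforced _ _ _ x r)
  ...     | ()

  -- Clause entries form a doubled edge or a triangle; for each
  -- variable z, the two terminal edges and the two paths of z give even degree
  -- because exactly one path has base multiplicity 1 (path-parity).
  terminals-and-paths-even : ∀ v z → 2 ∣ degreeIn (terminalEntries z) v + degreeIn (bothPaths z) v
  terminals-and-paths-even v z =
    subst (λ d → 2 ∣ degreeIn (terminalEntries z) v + d) (sym (∑-++ (pathOf true z) (pathOf false z) _))
      (one-path-walked (σ⁺ z) _ _ (isAt v s) (isAt v (tL z)) (isAt v (tR z))
        (path-parity v (base true z) (surplus z) (tL z) (map (oc z) (P z)) (tR z))
        (path-parity v (base false z) (surplus z) (tL z) (map (oc z) (N z)) (tR z)))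

  triangle-even : ∀ v z a a′ → 2 ∣ degreeIn (triangleEntries z a a′) v
  triangle-even v z a a′ = ∣-resp-≡ (triangle-degree (isAt v z) (isAt v a) (isAt v a′)) (m∣m*n (isAt v z + isAt v a + isAt v a′))

  clause-even : ∀ v c → 2 ∣ degreeIn (clauseEntries c) v
  clause-even v c@(C2 i j k) = ∣-resp-≡ (double-edge-degree (isAt v x) (isAt v y)) (m∣m*n (isAt v x + isAt v y))
    where
    x y : W
    x = oc (X i j) c
    y = oc (Y i k) c
  clause-even v c@(C3 ℓ f0) = triangle-even v (oc (xo ℓ f0) c) (oc (A ℓ f0) c) (oc (A ℓ (fs f0)) c)
  clause-even v c@(C3 ℓ (fs f0)) = triangle-even v (oc (xo ℓ (fs f0)) c) (oc (A ℓ (fs f0)) c) (oc (A ℓ (fs (fs f0))) c)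
  clause-even v c@(C3 ℓ (fs (fs f0))) = triangle-even v (oc (xo ℓ (fs (fs f0))) c) (oc (A ℓ f0) c) (oc (A ℓ (fs (fs f0))) c)

  degrees-even : ∀ v → 2 ∣ degreeIn tourEntries v
  degrees-even v = ∣-resp-≡ split
    (∣m∣n⇒∣m+n (∣-resp-≡ (sym (∑-+ allVars (λ z → degreeIn (terminalEntries z) v) (λ z → degreeIn (bothPaths z) v)))
                         (∑-even allVars _ (λ z _ → terminals-and-paths-even v z)))
               (∑-even allClauses _ (λ c _ → clause-even v c)))
    where
    Tm Cs Pa : ℕ
    Tm = ∑ allVars (λ z → degreeIn (terminalEntries z) v)
    Cs = ∑ allClauses (λ c → degreeIn (clauseEntries c) v)
    Pa = ∑ allVars (λ z → degreeIn (bothPaths z) v)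
    split : degreeIn tourEntries v ≡ (Tm + Pa) + Cs
    split = trans (∑-++ (concatMap terminalEntries allVars) _ _)
      (trans (cong₂ _+_ (∑-concatMap terminalEntries allVars _)
                        (trans (∑-++ (concatMap clauseEntries allClauses) _ _)
                               (cong₂ _+_ (∑-concatMap clauseEntries allClauses _) (∑-concatMap bothPaths allVars _))))
             (reorder Tm Cs Pa))
      where
      reorder : ∀ a b c → a + (b + c) ≡ (a + c) + b
      reorder = solve-∀

  weights-ok : All WeightOK tourEntries
  weights-ok = ++⁺ (All-concatMap terminalEntries allVars terminal)
                   (++⁺ (All-concatMap clauseEntries allClauses clause)
                        (All-concatMap bothPaths allVars (λ z → ++⁺ (path (base true z) (surplus z) (pathVertices z (P z)))
                                                                    (path (base false z) (surplus z) (pathVertices z (N z))))))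
    where
    terminal : ∀ z → All WeightOK (terminalEntries z)
    terminal (X _ _) = *≡* refl ∷ *≡* refl ∷ []
    terminal (Y _ _) = *≡* refl ∷ *≡* refl ∷ []
    terminal (A _ _) = *≡* refl ∷ *≡* refl ∷ []
    clause : ∀ c → All WeightOK (clauseEntries c)
    clause (C2 i j k) = *≡* refl ∷ *≡* refl ∷ []
    clause (C3 ℓ f0) = *≡* refl ∷ *≡* refl ∷ *≡* refl ∷ []
    clause (C3 ℓ (fs f0)) = *≡* refl ∷ *≡* refl ∷ *≡* refl ∷ []
    clause (C3 ℓ (fs (fs f0))) = *≡* refl ∷ *≡* refl ∷ *≡* refl ∷ []
    path : ∀ b g vs → All WeightOK (pathEntries b g vs)
    path b g [] = []
    path b g (u ∷ []) = []
    path b g (u ∷ v ∷ r) = *≡* refl ∷ path b g (v ∷ r)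

  ValidV : V → Set
  ValidV (X i j) = j < deg S i
  ValidV (Y i k) = k < rsz S i
  ValidV (A _ _) = ⊤

  varBlock : Fin (n S) → List V
  varBlock i = map (X i) (upTo (deg S i)) ++ map (Y i) (upTo (rsz S i))

  auxBlock : Fin (m S) → List V
  auxBlock ℓ = map (A ℓ) (allFin 3)

  checkerClauses : Fin (n S) → ℕ → List C
  checkerClauses i j = map (C2 i j) (filterᵇ (H i j) (upTo (rsz S i)))

  twoLiteralClauses : Fin (n S) → List C
  twoLiteralClauses i = concatMap (checkerClauses i) (upTo (deg S i))

  gadgetClauses : Fin (m S) → List C
  gadgetClauses ℓ = map (C3 ℓ) (allFin 3)

  valid-var : ∀ z → ValidV z → z ∈ allVars
  valid-var (X i j) j< = ∈-++⁺ˡ (∈-concatMap-intro varBlock (∈-allFin i) (∈-++⁺ˡ (∈-map⁺ (X i) (∈-upTo⁺ j<))))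
  valid-var (Y i k) k< = ∈-++⁺ˡ (∈-concatMap-intro varBlock (∈-allFin i) (∈-++⁺ʳ (map (X i) (upTo (deg S i))) (∈-map⁺ (Y i) (∈-upTo⁺ k<))))
  valid-var (A ℓ t) _ = ∈-++⁺ʳ (concatMap varBlock (allFin (n S))) (∈-concatMap-intro auxBlock (∈-allFin ℓ) (∈-map⁺ (A ℓ) (∈-allFin t)))

  ValidC : C → Set
  ValidC (C2 i j k) = j < deg S i × k < rsz S i
  ValidC (C3 ℓ p) = ⊤

  valid-clause : ∀ {c} → c ∈ allClauses → ValidC c
  valid-clause c∈ with ∈-++⁻ (concatMap twoLiteralClauses (allFin (n S))) c∈
  ... | inj₂ q with ∈-concatMap-elim gadgetClauses (allFin (m S)) q
  ...   | ℓ , _ , r with ∈-map⁻ (C3 ℓ) r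
  ...     | p , _ , refl = tt
  valid-clause c∈ | inj₁ q with ∈-concatMap-elim twoLiteralClauses (allFin (n S)) q
  ... | i , _ , r with ∈-concatMap-elim (checkerClauses i) (upTo (deg S i)) r
  ...   | j , j∈ , t with ∈-map⁻ (C2 i j) t
  ...     | k , k∈ , refl = ∈-upTo⁻ j∈ , ∈-upTo⁻ (proj₁ (∈-filterᵇ-elim (H i j) (upTo (rsz S i)) k∈))

  valid-literal : ∀ {c} → c ∈ allClauses → ∀ {l} → l ∈ lits c → ValidV (lv l)
  valid-literal {C2 i j k} c∈ (here refl) = proj₁ (valid-clause c∈)
  valid-literal {C2 i j k} c∈ (there (here refl)) = proj₂ (valid-clause c∈)
  valid-literal {C3 ℓ f0} c∈ (here refl) = numBound ℓ f0
  valid-literal {C3 ℓ (fs f0)} c∈ (here refl) = numBound ℓ (fs f0)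
  valid-literal {C3 ℓ (fs (fs f0))} c∈ (here refl) = numBound ℓ (fs (fs f0))
  valid-literal {C3 ℓ f0} c∈ (there (here refl)) = tt
  valid-literal {C3 ℓ f0} c∈ (there (there (here refl))) = tt
  valid-literal {C3 ℓ (fs f0)} c∈ (there (here refl)) = tt
  valid-literal {C3 ℓ (fs f0)} c∈ (there (there (here refl))) = tt
  valid-literal {C3 ℓ (fs (fs f0))} c∈ (there (here refl)) = tt
  valid-literal {C3 ℓ (fs (fs f0))} c∈ (there (there (here refl))) = tt

  literal-var : ∀ {c} → c ∈ allClauses → ∀ {l} → l ∈ lits c → lv l ∈ allVars
  literal-var c∈ l∈ = valid-var _ (valid-literal c∈ l∈)

  order-perm : ∀ p z → order p z ↭ filterᵇ (occursWith p z) allClauses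
  order-perm true = Porder
  order-perm false = Norder

  on-path : ∀ p z {c} → c ∈ allClauses → occursWith p z c ≡ true → c ∈ order p z
  on-path p z c∈ occ = ∈-resp-↭ (↭-sym (order-perm p z)) (∈-filterᵇ-intro (occursWith p z) allClauses c∈ occ)

  from-path : ∀ p z {c} → c ∈ order p z → c ∈ allClauses × occursWith p z c ≡ true
  from-path p z c∈ = ∈-filterᵇ-elim (occursWith p z) allClauses (∈-resp-↭ (order-perm p z) c∈)

  literal-occurs : ∀ {c l} → l ∈ lits c → occursWith (lpos l) (lv l) c ≡ true
  literal-occurs {c} {l} l∈ =
    anyB-intro (λ l′ → eqV3 (lv l′) (lv l) ∧ (if lpos l′ then lpos l else not (lpos l))) (lits c) l∈
               (subst (λ b → (b ∧ (if lpos l then lpos l else not (lpos l))) ≡ true) (sym (eqV3-refl (lv l))) (self (lpos l)))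
    where
    self : ∀ b → (if b then b else not b) ≡ true
    self true = refl
    self false = refl

  -- Connectivity: every vertex reaches s through used edges.
  Reach : W → Set
  Reach w = Star (Link tourEntries) w s

  backwards : ∀ {u v} → Star (Link tourEntries) u v → Star (Link tourEntries) v u
  backwards = reverse link-sym

  terminal∈ : ∀ {z} → z ∈ allVars → ∀ {x} → x ∈ terminalEntries z → x ∈ tourEntries
  terminal∈ z∈ x∈ = ∈-++⁺ˡ (∈-concatMap-intro terminalEntries z∈ x∈)

  clause∈ : ∀ {c} → c ∈ allClauses → ∀ {x} → x ∈ clauseEntries c → x ∈ tourEntries
  clause∈ c∈ x∈ = ∈-++⁺ʳ (concatMap terminalEntries allVars) (∈-++⁺ˡ (∈-concatMap-intro clauseEntries c∈ x∈))

  path∈ : ∀ p {z} → z ∈ allVars → ∀ x → x ∈ pathOf p z → x ∈ tourEntries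
  path∈ p {z} z∈ x x∈ = ∈-++⁺ʳ (concatMap terminalEntries allVars)
    (∈-++⁺ʳ (concatMap clauseEntries allClauses) (∈-concatMap-intro bothPaths z∈ (onBoth p x∈)))
    where
    onBoth : ∀ p → x ∈ pathOf p z → x ∈ bothPaths z
    onBoth true x∈ = ∈-++⁺ˡ x∈
    onBoth false x∈ = ∈-++⁺ʳ (pathOf true z) x∈

  reach-tL : ∀ {z} → z ∈ allVars → Reach (tL z)
  reach-tL {z} z∈ = (entry (edge s (tL z) (wTerm z) true) 1 (terminal20 z) , terminal∈ z∈ (here refl) , s≤s z≤n , inj₂ (refl , refl)) ◅ ε

  reach-tR : ∀ {z} → z ∈ allVars → Reach (tR z)
  reach-tR {z} z∈ = (entry (edge s (tR z) (wTerm z) true) 1 (terminal20 z) , terminal∈ z∈ (there (here refl)) , s≤s z≤n , inj₂ (refl , refl)) ◅ ε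

  reach-along : ∀ p z → z ∈ allVars → (∀ c → c ∈ order p z → Reach (oc z c) ⊎ 1 ≤ base p z + 2 * surplus z (oc z c)) →
                ∀ c → c ∈ order p z → Reach (oc z c)
  reach-along p z z∈ step c c∈ =
    path-reach tourEntries s (base p z) (surplus z) (tL z) (map (oc z) (order p z) ++ tR z ∷ [])
               (path∈ p z∈) (reach-tL z∈) step′ (oc z c) (∈-++⁺ˡ (∈-map⁺ (oc z) c∈))
    where
    step′ : ∀ w → w ∈ map (oc z) (order p z) ++ tR z ∷ [] → Reach w ⊎ 1 ≤ base p z + 2 * surplus z w
    step′ w w∈ with ∈-++⁻ (map (oc z) (order p z)) w∈
    ... | inj₂ (here refl) = inj₁ (reach-tR z∈)
    ... | inj₁ q with ∈-map⁻ (oc z) q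
    ...   | c′ , c′∈ , refl = step c′ c′∈

  -- The occurrence vertex of a true literal reaches s: its path is walked.
  reach-true-literal : ∀ {c} → c ∈ allClauses → ∀ {l} → l ∈ lits c → litVal σ⁺ l ≡ true → Reach (oc (lv l) c)
  reach-true-literal c∈ {l} l∈ true-l =
    reach-along (lpos l) (lv l) (literal-var c∈ l∈) (λ _ _ → inj₂ (walked l true-l)) _ (on-path (lpos l) (lv l) c∈ (literal-occurs l∈))
    where
    walked : ∀ l {k} → litVal σ⁺ l ≡ true → 1 ≤ base (lpos l) (lv l) + k
    walked (lit z true) e rewrite e = s≤s z≤n
    walked (lit z false) e rewrite e = s≤s z≤n

  mainVar : C → V
  mainVar (C2 i j k) = X i j
  mainVar (C3 ℓ p) = xo ℓ p

  mainPol : C → Bool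
  mainPol (C2 i j k) = true
  mainPol (C3 ℓ f0) = rhs S ℓ
  mainPol (C3 ℓ (fs _)) = true

  mainLit∈ : ∀ c → lit (mainVar c) (mainPol c) ∈ lits c
  mainLit∈ (C2 i j k) = here refl
  mainLit∈ (C3 ℓ f0) = here refl
  mainLit∈ (C3 ℓ (fs f0)) = here refl
  mainLit∈ (C3 ℓ (fs (fs f0))) = here refl

  mainVar-isMain : ∀ c → isMain (mainVar c) ≡ true
  mainVar-isMain (C2 i j k) = refl
  mainVar-isMain (C3 ℓ p) = refl

  -- Inside a clause gadget every occurrence vertex is joined to the main one by a forced edge.
  to-main : ∀ {c} → c ∈ allClauses → ∀ {l} → l ∈ lits c → Star (Link tourEntries) (oc (lv l) c) (oc (mainVar c) c)
  to-main {C2 i j k} c∈ (here refl) = ε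
  to-main {C2 i j k} c∈ (there (here refl)) = (_ , clause∈ c∈ (here refl) , s≤s z≤n , inj₂ (refl , refl)) ◅ ε
  to-main {C3 ℓ f0} c∈ (here refl) = ε
  to-main {C3 ℓ f0} c∈ (there (here refl)) = (_ , clause∈ c∈ (here refl) , s≤s z≤n , inj₂ (refl , refl)) ◅ ε
  to-main {C3 ℓ f0} c∈ (there (there (here refl))) = (_ , clause∈ c∈ (there (here refl)) , s≤s z≤n , inj₂ (refl , refl)) ◅ ε
  to-main {C3 ℓ (fs f0)} c∈ (here refl) = ε
  to-main {C3 ℓ (fs f0)} c∈ (there (here refl)) = (_ , clause∈ c∈ (here refl) , s≤s z≤n , inj₂ (refl , refl)) ◅ ε
  to-main {C3 ℓ (fs f0)} c∈ (there (there (here refl))) = (_ , clause∈ c∈ (there (here refl)) , s≤s z≤n , inj₂ (refl , refl)) ◅ ε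
  to-main {C3 ℓ (fs (fs f0))} c∈ (here refl) = ε
  to-main {C3 ℓ (fs (fs f0))} c∈ (there (here refl)) = (_ , clause∈ c∈ (here refl) , s≤s z≤n , inj₂ (refl , refl)) ◅ ε
  to-main {C3 ℓ (fs (fs f0))} c∈ (there (there (here refl))) = (_ , clause∈ c∈ (there (here refl)) , s≤s z≤n , inj₂ (refl , refl)) ◅ ε

  reach-live : ∀ {c} → c ∈ allClauses → ∀ {l} → l ∈ lits c → litVal σ⁺ l ≡ true → Reach (oc (mainVar c) c)
  reach-live c∈ l∈ true-l = backwards (to-main c∈ l∈) ◅◅ reach-true-literal c∈ l∈ true-l

  -- Walk the
  -- path of its main literal: each occurrence vertex on it belongs to a live
  -- clause (reach-live) or to a dead one, whose entering edge is doubled.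
  reach-main : ∀ {c} → c ∈ allClauses → Reach (oc (mainVar c) c)
  reach-main {c} c∈ = reach-along (mainPol c) x (literal-var c∈ (mainLit∈ c)) step c
                                  (on-path (mainPol c) x c∈ (literal-occurs (mainLit∈ c)))
    where
    x = mainVar c
    step : ∀ c′ → c′ ∈ order (mainPol c) x → Reach (oc x c′) ⊎ 1 ≤ base (mainPol c) x + 2 * surplus x (oc x c′)
    step c′ c′∈ with from-path (mainPol c) x c′∈
    ... | c′∈all , occ with dead c′ in isDead
    ...   | true = inj₂ (≤-trans (doubled (cong (_∧ true) (mainVar-isMain c))) (m≤n+m _ (base (mainPol c) x)))
      where
      doubled : ∀ {b} → b ≡ true → 1 ≤ 2 * ind b
      doubled refl = s≤s z≤n
    ...   | false with countB-witness (litVal σ⁺) (lits c′) isDead | anyB-witness _ (lits c′) occ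
    ...     | l , l∈ , true-l | l′ , l′∈ , l′-is-x =
      inj₁ (subst (λ z → Reach (oc z c′)) (eqV3-sound (proj₁ (∧-true {eqV3 (lv l′) x} l′-is-x)))
                  (to-main c′∈all l′∈ ◅◅ reach-live c′∈all l∈ true-l))

  reach-vertex : ∀ {w} → w ∈ verticesG → Reach w
  reach-vertex (here refl) = ε
  reach-vertex (there w∈) with ∈-++⁻ (concatMap (λ z → tL z ∷ tR z ∷ []) allVars) w∈
  ... | inj₁ q with ∈-concatMap-elim (λ z → tL z ∷ tR z ∷ []) allVars q
  ...   | z , z∈ , here refl = reach-tL z∈
  ...   | z , z∈ , there (here refl) = reach-tR z∈
  reach-vertex (there w∈) | inj₂ q with ∈-concatMap-elim (λ c → map (λ l → oc (lv l) c) (lits c)) allClauses q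
  ... | c , c∈ , r with ∈-map⁻ (λ l → oc (lv l) c) r
  ...   | l , l∈ , refl = to-main c∈ l∈ ◅◅ reach-main c∈

  connected : ∀ u v → u ∈ verticesG → v ∈ verticesG → Star (Link tourEntries) u v
  connected u v u∈ v∈ = reach-vertex u∈ ◅◅ backwards (reach-vertex v∈)

  ∑-allVars : (h : V → ℕ) → ∑ allVars h ≡ ∑ (allFin (n S)) (λ i → ∑ (upTo (deg S i)) (λ j → h (X i j)) + ∑ (upTo (rsz S i)) (λ k → h (Y i k)))
                                          + ∑ (allFin (m S)) (λ ℓ → ∑ (auxBlock ℓ) h)
  ∑-allVars h = trans (∑-++ (concatMap varBlock (allFin (n S))) _ h)
    (cong₂ _+_ (trans (∑-concatMap varBlock (allFin (n S)) h)
                      (∑-cong (allFin (n S)) (λ i _ → trans (∑-++ (map (X i) (upTo (deg S i))) _ h)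
                                                         (cong₂ _+_ (∑-map (X i) (upTo (deg S i)) h) (∑-map (Y i) (upTo (rsz S i)) h)))))
               (∑-concatMap auxBlock (allFin (m S)) h))

  ∑-allVars-select : ∀ v → ValidV v → (G : V → ℕ) → ∑ allVars (λ z → if eqV3 v z then G z else 0) ≡ G v
  ∑-allVars-select (X i₀ j₀) j₀< G =
    trans (∑-allVars _) (trans (cong₂ _+_ (trans (∑-cong (allFin (n S)) block) (∑-select-Fin i₀ (λ i → G (X i j₀))))
                                          (∑-zero (allFin (m S)) _ (λ _ _ → refl))) (+-identityʳ _))
    where
    block : ∀ i → i ∈ allFin (n S) → ∑ (upTo (deg S i)) (λ j → if eqF i₀ i ∧ (j₀ ≡ᵇ j) then G (X i j) else 0)
                                     + ∑ (upTo (rsz S i)) (λ k → 0) ≡ (if eqF i₀ i then G (X i j₀) else 0)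
    block i _ with eqF i₀ i in e
    ... | false = cong₂ _+_ (∑-zero (upTo (deg S i)) _ (λ _ _ → refl)) (∑-zero (upTo (rsz S i)) _ (λ _ _ → refl))
    ... | true with eqF-sound {i = i₀} {j = i} e
    ...   | refl = trans (cong₂ _+_ (∑-select-upTo (deg S i₀) j₀ j₀< (λ j → G (X i₀ j))) (∑-zero (upTo (rsz S i₀)) _ (λ _ _ → refl)))
                         (+-identityʳ _)
  ∑-allVars-select (Y i₀ k₀) k₀< G =
    trans (∑-allVars _) (trans (cong₂ _+_ (trans (∑-cong (allFin (n S)) block) (∑-select-Fin i₀ (λ i → G (Y i k₀))))
                                          (∑-zero (allFin (m S)) _ (λ _ _ → refl))) (+-identityʳ _))
    where
    block : ∀ i → i ∈ allFin (n S) → ∑ (upTo (deg S i)) (λ j → 0)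
                                     + ∑ (upTo (rsz S i)) (λ k → if eqF i₀ i ∧ (k₀ ≡ᵇ k) then G (Y i k) else 0) ≡ (if eqF i₀ i then G (Y i k₀) else 0)
    block i _ with eqF i₀ i in e
    ... | false = cong₂ _+_ (∑-zero (upTo (deg S i)) _ (λ _ _ → refl)) (∑-zero (upTo (rsz S i)) _ (λ _ _ → refl))
    ... | true with eqF-sound {i = i₀} {j = i} e
    ...   | refl = cong₂ _+_ (∑-zero (upTo (deg S i₀)) _ (λ _ _ → refl)) (∑-select-upTo (rsz S i₀) k₀ k₀< (λ k → G (Y i₀ k)))
  ∑-allVars-select (A ℓ₀ t₀) _ G =
    trans (∑-allVars _) (cong₂ _+_ (∑-zero (allFin (n S)) _ (λ i _ → cong₂ _+_ (∑-zero (upTo (deg S i)) _ (λ _ _ → refl))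
                                                                               (∑-zero (upTo (rsz S i)) _ (λ _ _ → refl))))
                                   (trans (∑-cong (allFin (m S)) block) (∑-select-Fin ℓ₀ (λ ℓ → G (A ℓ t₀)))))
    where
    block : ∀ ℓ → ℓ ∈ allFin (m S) → ∑ (auxBlock ℓ) (λ z → if eqV3 (A ℓ₀ t₀) z then G z else 0) ≡ (if eqF ℓ₀ ℓ then G (A ℓ t₀) else 0)
    block ℓ _ with eqF ℓ₀ ℓ in e
    ... | false = refl
    ... | true with eqF-sound {i = ℓ₀} {j = ℓ} e
    ...   | refl = ∑-select-Fin t₀ (λ t → G (A ℓ₀ t))

  literals-distinct : ∀ c → AllPairs (λ l l′ → lv l ≢ lv l′) (lits c)
  literals-distinct (C2 i j k) = ((λ ()) ∷ []) ∷ [] ∷ []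
  literals-distinct (C3 ℓ f0) = ((λ ()) ∷ (λ ()) ∷ []) ∷ ((λ ()) ∷ []) ∷ [] ∷ []
  literals-distinct (C3 ℓ (fs f0)) = ((λ ()) ∷ (λ ()) ∷ []) ∷ ((λ ()) ∷ []) ∷ [] ∷ []
  literals-distinct (C3 ℓ (fs (fs f0))) = ((λ ()) ∷ (λ ()) ∷ []) ∷ ((λ ()) ∷ []) ∷ [] ∷ []

  ∑-occurs : ∀ {c} → c ∈ allClauses → ∀ p (G : V → ℕ) →
             ∑ allVars (λ z → if occursWith p z c then G z else 0) ≡ ∑ (lits c) (λ l → if hasPol p l then G (lv l) else 0)
  ∑-occurs {c} c∈ p G =
    trans (∑-cong allVars (λ z _ → occurs-as-sum (lits c) (literals-distinct c) z (hasPol p) (G z)))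
      (trans (∑-swap allVars (lits c) (λ z l → if eqV3 (lv l) z ∧ hasPol p l then G z else 0))
             (∑-cong (lits c) perLiteral))
    where
    perLiteral : ∀ l → l ∈ lits c → ∑ allVars (λ z → if eqV3 (lv l) z ∧ hasPol p l then G z else 0) ≡ (if hasPol p l then G (lv l) else 0)
    perLiteral l l∈ with hasPol p l
    ... | true = trans (∑-cong allVars (λ z _ → cong (λ b → if b then G z else 0) (∧-identityʳ (eqV3 (lv l) z))))
                       (∑-allVars-select (lv l) (valid-literal c∈ l∈) G)
    ... | false = ∑-zero allVars _ (λ z _ → cong (λ b → if b then G z else 0) (∧-zeroʳ (eqV3 (lv l) z)))

  onPath : Bool → V → C → ℕ
  onPath p z c = base p z + 2 * surplus z (oc z c)

  -- All path edges of z, except the ones entering tR z.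
  pathCharge : V → ℕ
  pathCharge z = ∑ (P z) (onPath true z) + ∑ (N z) (onPath false z)

  entryCost : Entry (n S) (m S) → ℕ
  entryCost x = mult x * w20 x

  -- Both paths of z cost 20 · pathCharge z, plus 20 for the one edge into tR z
  -- that is walked (exactly one of the two bases is 1).
  both-paths-cost : ∀ z → ∑ (bothPaths z) entryCost ≡ 20 * pathCharge z + 20
  both-paths-cost z = trans (∑-++ (pathOf true z) (pathOf false z) entryCost)
    (trans (cong₂ _+_ (one-path true (P z)) (one-path false (N z)))
    (trans (regroup (∑ (P z) (onPath true z)) (∑ (N z) (onPath false z)) (base true z) (base false z))
           (cong (λ t → 20 * pathCharge z + 20 * t) (bases-sum (σ⁺ z)))))
    where
    one-path : ∀ p L → ∑ (pathEntries (base p z) (surplus z) (pathVertices z L)) entryCost ≡ 20 * ∑ L (onPath p z) + 20 * base p z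
    one-path p L = trans (path-cost (base p z) (surplus z) (tL z) (map (oc z) L ++ tR z ∷ []))
      (trans (cong (20 *_) (trans (∑-++ (map (oc z) L) (tR z ∷ []) _) (cong (_+ (base p z + 0 + 0)) (∑-map (oc z) L _))))
             (distrib (∑ L (onPath p z)) (base p z)))
      where
      distrib : ∀ a b → 20 * (a + (b + 0 + 0)) ≡ 20 * a + 20 * b
      distrib = solve-∀
    regroup : ∀ a b x y → 20 * a + 20 * x + (20 * b + 20 * y) ≡ 20 * (a + b) + 20 * (x + y)
    regroup = solve-∀
    bases-sum : ∀ b → ind b + ind (not b) ≡ 1
    bases-sum true = refl
    bases-sum false = refl

  -- Double counting: the path charges of all variables, regrouped by clause.
  double-count : ∑ allVars pathCharge ≡ ∑ allClauses (λ c → ∑ (lits c) (λ l → onPath (lpos l) (lv l) c))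
  double-count =
    trans (∑-cong allVars (λ z _ → trans (cong₂ _+_ (by-clauses true z) (by-clauses false z)) (sym (∑-+ allClauses _ _))))
      (trans (∑-swap allVars allClauses (λ z c → occurring true z c + occurring false z c))
             (∑-cong allClauses perClause))
    where
    occurring : Bool → V → C → ℕ
    occurring p z c = if occursWith p z c then onPath p z c else 0
    by-clauses : ∀ p z → ∑ (order p z) (onPath p z) ≡ ∑ allClauses (occurring p z)
    by-clauses p z = trans (∑-↭ (onPath p z) (order-perm p z)) (∑-filter (occursWith p z) allClauses (onPath p z))
    perClause : ∀ c → c ∈ allClauses → ∑ allVars (λ z → occurring true z c + occurring false z c) ≡ ∑ (lits c) (λ l → onPath (lpos l) (lv l) c)
    perClause c c∈ = trans (∑-+ allVars (λ z → occurring true z c) (λ z → occurring false z c))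
      (trans (cong₂ _+_ (∑-occurs c∈ true (λ z → onPath true z c)) (∑-occurs c∈ false (λ z → onPath false z c)))
      (trans (sym (∑-+ (lits c) _ _)) (∑-cong (lits c) (λ l _ → polarity-split l (λ p → onPath p (lv l) c)))))

  -- Per clause: one unit per true literal, plus 2 on the main literal if the clause is dead.
  clause-charge : ∀ c → ∑ (lits c) (λ l → onPath (lpos l) (lv l) c) ≡ charge (trueCount c)
  clause-charge c =
    trans (∑-cong (lits c) (λ l _ → cong (_+ 2 * ind (isMain (lv l) ∧ dead c)) (base-literal l)))
      (trans (∑-+ (lits c) (λ l → ind (litVal σ⁺ l)) (λ l → 2 * ind (isMain (lv l) ∧ dead c)))
             (cong₂ _+_ (sym (countB-∑ (litVal σ⁺) (lits c)))
                        (trans (∑-*ˡ (lits c) 2 _) (cong (2 *_) (one-main c)))))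
    where
    base-literal : ∀ l → base (lpos l) (lv l) ≡ ind (litVal σ⁺ l)
    base-literal (lit z true) = refl
    base-literal (lit z false) = refl
    one-main : ∀ c → ∑ (lits c) (λ l → ind (isMain (lv l) ∧ dead c)) ≡ ind (dead c)
    one-main (C2 i j k) = +-identityʳ _
    one-main (C3 ℓ f0) = +-identityʳ _
    one-main (C3 ℓ (fs f0)) = +-identityʳ _
    one-main (C3 ℓ (fs (fs f0))) = +-identityʳ _

  allowanceσ : C → ℕ
  allowanceσ c = allowance (countB (litVal σ) (lits c))

  -- Summing the clause-wise bounds: checker clauses by clause2-lemma, each
  -- equation gadget as a whole by gadget-lemma.
  charges-bounded : ∑ allClauses (λ c → charge (trueCount c)) ≤ ∑ allClauses allowanceσ
  charges-bounded = subst₂ _≤_ (sym (by-blocks _)) (sym (by-blocks _))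
    (+-mono-≤ (∑-mono (allFin (n S)) (λ i _ → checkers i)) (∑-mono (allFin (m S)) (λ ℓ _ → gadget ℓ)))
    where
    by-blocks : ∀ f → ∑ allClauses f ≡ ∑ (allFin (n S)) (λ i → ∑ (twoLiteralClauses i) f) + ∑ (allFin (m S)) (λ ℓ → ∑ (gadgetClauses ℓ) f)
    by-blocks f = trans (∑-++ (concatMap twoLiteralClauses (allFin (n S))) _ f)
                        (cong₂ _+_ (∑-concatMap twoLiteralClauses (allFin (n S)) f) (∑-concatMap gadgetClauses (allFin (m S)) f))
    checkers : ∀ i → ∑ (twoLiteralClauses i) (λ c → charge (trueCount c)) ≤ ∑ (twoLiteralClauses i) allowanceσ
    checkers i = subst₂ _≤_ (sym (by-edges _)) (sym (by-edges _))
      (∑-mono (upTo (deg S i)) (λ j _ → ∑-mono (filterᵇ (H i j) (upTo (rsz S i))) (λ k _ → clause2-lemma (σ (X i j)) (σ (Y i k)))))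
      where
      by-edges : ∀ f → ∑ (twoLiteralClauses i) f ≡ ∑ (upTo (deg S i)) (λ j → ∑ (filterᵇ (H i j) (upTo (rsz S i))) (λ k → f (C2 i j k)))
      by-edges f = trans (∑-concatMap (checkerClauses i) (upTo (deg S i)) f)
                         (∑-cong (upTo (deg S i)) (λ j _ → ∑-map (C2 i j) (filterᵇ (H i j) (upTo (rsz S i))) f))
    gadget : ∀ ℓ → ∑ (gadgetClauses ℓ) (λ c → charge (trueCount c)) ≤ ∑ (gadgetClauses ℓ) allowanceσ
    gadget ℓ = subst (λ a → charge (count3 a (o f0) (o (fs f0))) + rest ≤ gadgetAllowance λ₀ x₂ x₃ (σ (A ℓ f0)) (σ (A ℓ (fs f0))) (σ (A ℓ (fs (fs f0)))))
                     (sym (first-literal (rhs S ℓ)))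
                     (gadget-lemma λ₀ x₂ x₃ (σ (A ℓ f0)) (σ (A ℓ (fs f0))) (σ (A ℓ (fs (fs f0)))))
      where
      λ₀ x₂ x₃ : Bool
      λ₀ = litVal σ (lit (xo ℓ f0) (rhs S ℓ))
      x₂ = σ (xo ℓ (fs f0))
      x₃ = σ (xo ℓ (fs (fs f0)))
      o : Fin 3 → Bool
      o = auxOpt λ₀ x₂ x₃
      rest : ℕ
      rest = charge (count3 x₂ (o (fs f0)) (o (fs (fs f0)))) + (charge (count3 x₃ (o f0) (o (fs (fs f0)))) + 0)
      -- σ and σ⁺ agree on main variables.
      first-literal : ∀ b → litVal σ⁺ (lit (xo ℓ f0) b) ≡ litVal σ (lit (xo ℓ f0) b)
      first-literal true = refl
      first-literal false = refl

  allowances-sum : ∑ allClauses allowanceσ ≡ ∑ allClauses (λ _ → 1) + numUnsat σ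
  allowances-sum = trans (∑-+ allClauses (λ _ → 1) (λ c → ind (not (satisfied σ c))))
                         (cong (_+_ (∑ allClauses (λ _ → 1))) (sym (countB-∑ (λ c → not (satisfied σ c)) allClauses)))

  -- Cost of the forced edges of a variable (twice its terminal weight) plus the
  -- one walked edge into tR z; cost of the forced edges of a clause.
  variableCost : V → ℕ
  variableCost z = ∑ (terminalEntries z) entryCost + 20

  clauseCost : C → ℕ
  clauseCost (C2 _ _ _) = 60
  clauseCost (C3 _ _) = 70

  clause-entries-cost : ∀ c → ∑ (clauseEntries c) entryCost ≡ clauseCost c
  clause-entries-cost (C2 i j k) = refl
  clause-entries-cost (C3 ℓ f0) = refl
  clause-entries-cost (C3 ℓ (fs f0)) = refl
  clause-entries-cost (C3 ℓ (fs (fs f0))) = refl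

  tour-cost : ∑ tourEntries entryCost ≡ (∑ allVars variableCost + 20 * ∑ allClauses (λ c → charge (trueCount c))) + ∑ allClauses clauseCost
  tour-cost =
    trans (∑-++ (concatMap terminalEntries allVars) _ entryCost)
    (trans (cong₂ _+_ (∑-concatMap terminalEntries allVars entryCost)
             (trans (∑-++ (concatMap clauseEntries allClauses) _ entryCost)
                (cong₂ _+_ (trans (∑-concatMap clauseEntries allClauses entryCost) (∑-cong allClauses (λ c _ → clause-entries-cost c)))
                           (trans (∑-concatMap bothPaths allVars entryCost) (∑-cong allVars (λ z _ → both-paths-cost z))))))
    (trans (reorder Tm Cs (∑ allVars (λ z → 20 * pathCharge z + 20)))
    (cong (_+ Cs)
      (trans (sym (∑-+ allVars (λ z → ∑ (terminalEntries z) entryCost) (λ z → 20 * pathCharge z + 20)))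
      (trans (∑-cong allVars (λ z _ → shift (∑ (terminalEntries z) entryCost) (pathCharge z)))
      (trans (∑-+ allVars variableCost (λ z → 20 * pathCharge z))
        (cong (_+_ (∑ allVars variableCost))
          (trans (∑-*ˡ allVars 20 pathCharge)
                 (cong (20 *_) (trans double-count (∑-cong allClauses (λ c _ → clause-charge c))))))))))))
    where
    Tm Cs : ℕ
    Tm = ∑ allVars (λ z → ∑ (terminalEntries z) entryCost)
    Cs = ∑ allClauses clauseCost
    reorder : ∀ a b c → a + (b + c) ≡ (a + c) + b
    reorder = solve-∀
    shift : ∀ a d → a + (20 * d + 20) ≡ (a + 20) + 20 * d
    shift = solve-∀

  degree-sum : ∑ (allFin (n S)) (deg S) ≡ 3 * m S
  degree-sum =
    trans (∑-cong (allFin (n S)) (λ i _ → countB-∑ (λ o → ⌊ var S (proj₁ o) (proj₂ o) ≟F i ⌋) (occs S)))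
    (trans (∑-swap (allFin (n S)) (occs S) (λ i o → ind ⌊ var S (proj₁ o) (proj₂ o) ≟F i ⌋))
    (trans (∑-cong (occs S) (λ o _ → trans (∑-cong (allFin (n S)) (λ i _ → cong ind (⌊≟F⌋≡eqF (var S (proj₁ o) (proj₂ o)) i)))
                                           (∑-select-Fin (var S (proj₁ o) (proj₂ o)) (λ _ → 1))))
    (trans (∑-const (occs S) 1)
    (trans (*-identityˡ _)
    (trans (length-cartesianProduct (allFin (m S)) (allFin 3))
    (trans (cong (_* 3) (length-allFin (m S))) (*-comm (m S) 3)))))))

  -- Per occurrence: 90 for x_{(i,j)}, 0.8 · 90 for the checkers, 4 · 80 for its
  -- checker clauses; per equation: 120 for the auxiliaries, 3 · 90 for its gadget.
  variables-cost : ∑ allVars variableCost ≡ ∑ (allFin (n S)) (λ i → 90 * deg S i + 90 * rsz S i) + 120 * m S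
  variables-cost = trans (∑-allVars variableCost) (cong₂ _+_
    (∑-cong (allFin (n S)) (λ i _ → cong₂ _+_ (trans (∑-const (upTo (deg S i)) 90) (cong (90 *_) (length-upTo (deg S i))))
                                              (trans (∑-const (upTo (rsz S i)) 90) (cong (90 *_) (length-upTo (rsz S i))))))
    (trans (∑-const (allFin (m S)) 120) (cong (120 *_) (length-allFin (m S)))))

  clauses-cost : ∑ allClauses (λ c → clauseCost c + 20) ≡ ∑ (allFin (n S)) (λ i → 320 * deg S i) + 270 * m S
  clauses-cost = trans (∑-++ (concatMap twoLiteralClauses (allFin (n S))) _ h) (cong₂ _+_
    (trans (∑-concatMap twoLiteralClauses (allFin (n S)) h) (∑-cong (allFin (n S)) (λ i _ →
      trans (∑-concatMap (checkerClauses i) (upTo (deg S i)) h)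
      (trans (∑-cong (upTo (deg S i)) (λ j j∈ →
                trans (∑-map (C2 i j) (filterᵇ (H i j) (upTo (rsz S i))) h)
                (trans (∑-const (filterᵇ (H i j) (upTo (rsz S i))) 80)
                       (cong (80 *_) (trans (length-filterᵇ (H i j) (upTo (rsz S i))) (Hleft i j (∈-upTo⁻ j∈)))))))
             (trans (∑-const (upTo (deg S i)) 320) (cong (320 *_) (length-upTo (deg S i))))))))
    (trans (∑-concatMap gadgetClauses (allFin (m S)) h) (trans (∑-const (allFin (m S)) 270) (cong (270 *_) (length-allFin (m S))))))
    where
    h : C → ℕ
    h c = clauseCost c + 20

  -- Using 0.8 d(i) = 4 d(i)/5 exactly: each occurrence costs 90 + 72 + 320 = 482.
  occurrence-cost : ∀ d → 5 ∣ d → 90 * d + 90 * ((4 * d) / 5) + 320 * d ≡ 482 * d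
  occurrence-cost d (divides q refl) = trans (cong (λ t → 90 * (q * 5) + 90 * t + 320 * (q * 5)) four-fifths) (arith q)
    where
    four-fifths : (4 * (q * 5)) / 5 ≡ 4 * q
    four-fifths = trans (cong (_/ 5) (sym (*-assoc 4 q 5))) (m*n/n≡m (4 * q) 5)
    arith : ∀ q → 90 * (q * 5) + 90 * (4 * q) + 320 * (q * 5) ≡ 482 * (q * 5)
    arith = solve-∀

  -- The fixed costs: 482 · 3m + 120 m + 270 m = 1836 m twentieths, i.e. 91.8 m.
  fixed-cost : ∑ allVars variableCost + ∑ allClauses (λ c → clauseCost c + 20) ≡ 1836 * m S
  fixed-cost = trans (cong₂ _+_ variables-cost clauses-cost)
    (trans (regroup (∑ (allFin (n S)) (λ i → 90 * deg S i + 90 * rsz S i)) (∑ (allFin (n S)) (λ i → 320 * deg S i)) (m S))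
    (trans (cong (_+ 390 * m S) (trans (sym (∑-+ (allFin (n S)) (λ i → 90 * deg S i + 90 * rsz S i) (λ i → 320 * deg S i)))
                                (trans (∑-cong (allFin (n S)) (λ i _ → occurrence-cost (deg S i) (degMul5 i)))
                                (trans (∑-*ˡ (allFin (n S)) 482 (deg S)) (cong (482 *_) degree-sum)))))
           (total (m S))))
    where
    regroup : ∀ a b m → a + 120 * m + (b + 270 * m) ≡ (a + b) + 390 * m
    regroup = solve-∀
    total : ∀ m → 482 * (3 * m) + 390 * m ≡ 1836 * m
    total = solve-∀

  cost-bound : ∀ k → numUnsat σ ≤ k → ∑ tourEntries entryCost ≤ 1836 * m S + 20 * k
  cost-bound k unsat≤k = begin
      ∑ tourEntries entryCost
    ≡⟨ tour-cost ⟩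
      (Vs + 20 * ∑ allClauses (λ c → charge (trueCount c))) + Cs
    ≤⟨ +-monoˡ-≤ Cs (+-monoʳ-≤ Vs (*-monoʳ-≤ 20 (≤-trans charges-bounded (≤-reflexive allowances-sum)))) ⟩
      (Vs + 20 * (#C + numUnsat σ)) + Cs
    ≡⟨ regroup Vs #C (numUnsat σ) Cs ⟩
      (Vs + (Cs + 20 * #C)) + 20 * numUnsat σ
    ≡⟨ cong (λ t → (Vs + t) + 20 * numUnsat σ) (sym (trans (∑-+ allClauses clauseCost (λ _ → 20)) (cong (_+_ Cs) (∑-*ˡ allClauses 20 (λ _ → 1))))) ⟩
      (Vs + ∑ allClauses (λ c → clauseCost c + 20)) + 20 * numUnsat σ
    ≡⟨ cong (_+ 20 * numUnsat σ) fixed-cost ⟩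
      1836 * m S + 20 * numUnsat σ
    ≤⟨ +-monoʳ-≤ (1836 * m S) (*-monoʳ-≤ 20 unsat≤k) ⟩
      1836 * m S + 20 * k
    ∎
    where
    open ≤-Reasoning
    Vs Cs #C : ℕ
    Vs = ∑ allVars variableCost
    Cs = ∑ allClauses clauseCost
    #C = ∑ allClauses (λ _ → 1)
    regroup : ∀ a c u b → (a + 20 * (c + u)) + b ≡ (a + (b + 20 * c)) + 20 * u
    regroup = solve-∀

lemma1 : (S : Sys) (num : Fin (m S) → Fin 3 → ℕ) (H : Fin (n S) → ℕ → ℕ → Bool)
         (P N : V3 (n S) (m S) → List (Cl (n S) (m S))) →
         Construction.Valid S num H P N →
         (k : ℕ) (σ : V3 (n S) (m S) → Bool) →
         Construction.numUnsat S num H σ ≤ k →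
         Σ (Construction.Graph.Mult S num H P N) (λ μ →
           Construction.Graph.IsTour S num H P N μ
           × (Construction.Graph.cost S num H P N μ ≤ℚ (+ (459 * m S) /ℚ 5) +ℚ (+ k /ℚ 1)))
lemma1 S num H P N valid k σ unsat≤k =
  tour-from-entries tourEntries verticesG _ forced-used degrees-even connected cost≤ edgesG edges-match
  where
  open Construction S num H
  open Graph P N
  open TourFor S num H P N valid σ
  cost≤ : sumℚ (map (λ x → ι (mult x) *ℚ ew (edgeOf x)) tourEntries) ≤ℚ (+ (459 * m S) /ℚ 5) +ℚ (+ k /ℚ 1)
  cost≤ = twentieths-bound _ (m S) k (cost-bound k unsat≤k) _ (cost-twentieths tourEntries weights-ok)
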